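{- Let $\mathbb{B}\subset\mathbb{A}_0$ be the subalgebra generated by $h_0,h_1,\dots,h_{n-1}$. For every $b\in\mathbb{B}$ and every $s\in S$ one has $\phi_0(bs)=\phi_0(s)\,b$ (where $bs$ is the product in $\mathbb{A}_{\mathrm{aff}}$). In other words $\mathbb{B}\subset\mathbb{B}'$, where $\mathbb{B}'=\{a\in\mathbb{A}_0:\phi_0(as)=\phi_0(s)a\text{ for all }s\in S\}$.
   Context: Type $A_{n-1}$ setting ($n\ge2$): $G=SL(n,\mathbb{C})$ with weight lattice $h^*_{\mathbb{Z}}$, simple roots $\alpha_1,\dots,\alpha_{n-1}$, highest root $\theta=\alpha_1+\dots+\alpha_{n-1}$, and put $\alpha_0:=-\theta$, $\alpha_0^\vee:=-\theta^\vee$. Indices are taken in $\mathbb{Z}/n\mathbb{Z}$. Let $r_i$ ($i\in\mathbb{Z}/n\mathbb{Z}$) act on $h^*_{\mathbb{Z}}$ by $r_i\lambda=\lambda-\langle\lambda,\alpha_i^\vee\rangle\alpha_i$, generating the affine symmetric group $W_{\mathrm{aff}}$ (translations act trivially). Let $S=\mathrm{Sym}(h^*_{\mathbb{Z}})$ (polynomial ring). The affine nilHecke ring $\mathbb{A}_{\mathrm{aff}}$ is the ring with 1 generated by $A_i$ ($i\in\mathbb{Z}/n\mathbb{Z}$) and $S$ (elements of $S$ commute with each other), subject to $A_i\lambda=(r_i\lambda)A_i+\langle\lambda,\alpha_i^\vee\rangle$ for $\lambda\in h^*_{\mathbb{Z}}$, $A_i^2=0$, and the braid relations of $W_{\mathrm{aff}}$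 among the $A_i$. For reduced $w=r_{i_1}\cdots r_{i_l}$, $A_w=A_{i_1}\cdots A_{i_l}$ is well defined and $\{A_w\}$ is a left $S$-basis of $\mathbb{A}_{\mathrm{aff}}$. The affine nilCoxeter algebra $\mathbb{A}_0$ is the subring generated by the $A_i$ (with $\mathbb{Z}$-basis $\{A_w\}$). The map $\phi_0:\mathbb{A}_{\mathrm{aff}}\to\mathbb{A}_0$ is $\sum_w a_wA_w\mapsto\sum_w a_w(0)A_w$, where $a_w(0)$ is the evaluation of $a_w\in S$ at $0$ (constant term). A word $a_1\cdots a_k$ of distinct letters in $\mathbb{Z}/n\mathbb{Z}$ with letter set $A$ is cyclically decreasing if whenever $i,i+1\in A$ the letter $i+1$ precedes $i$; $w\in W_{\mathrm{aff}}$ is cyclically decreasing if $w=r_{a_1}\cdots r_{a_k}$ for such a word. For $i\in[0,n-1]$, $h_i=\sum A_w$ summed over cyclically decreasing $w$ of length $i$ ($h_0=1$). -}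

module Defs where

-- Concrete model of the affine nilHecke ring of type A_{n-1}, n = suc m.
-- Index set Z/nZ is Fin (suc m): `zero` is the affine node 0, `suc j` is node j+1.

open import Data.Nat as ℕ using (ℕ; zero; suc)
open import Data.Nat.DivMod using (_mod_)
open import Data.Integer as ℤ using (ℤ; +_; _+_; _-_; _*_; -_; _<?_)
open import Data.Fin as Fin using (Fin; zero; suc; toℕ; inject₁; fromℕ)
open import Data.Fin.Properties as FinP using (_≟_)
open import Data.Bool using (Bool; true; false; if_then_else_; _∧_; not)
open import Data.Maybe using (Maybe; just; nothing; is-just)
import Data.Maybe.Properties as MaybeP
open import Data.Vec as Vec using (Vec; lookup; tabulate)
import Data.Vec.Properties as VecP
open import Data.List as List using (List; []; _∷_; map; concatMap; foldr; filter; deduplicate; allFin)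
open import Data.Bool.ListAction using (any)
open import Data.Product using (_×_; _,_)
open import Relation.Nullary using (does; yes; no)
open import Relation.Nullary.Decidable using (T?; ⌊_⌋)
open import Relation.Binary.PropositionalEquality using (_≡_)
open import Function using (_∘_)

-- Weights: h*_Z with basis the fundamental weights ω_1..ω_m

Weight : ℕ → Set
Weight m = Fin m → ℤ

sumℤ : List ℤ → ℤ
sumℤ = foldr _+_ (+ 0)

cartan : ∀ {m} → Fin m → Fin m → ℤ
cartan k j with toℕ k ℕ.≟ toℕ j | toℕ k ℕ.≟ suc (toℕ j) | suc (toℕ k) ℕ.≟ toℕ j
... | yes _ | _ | _ = + 2
... | no _ | yes _ | _ = - + 1
... | no _ | no _ | yes _ = - + 1
... | no _ | no _ | no _ = + 0

-- simple roots α_i in the ω-basis; α_0 = -θ = -(α_1 + ... + α_m)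
α : ∀ {m} → Fin (suc m) → Weight m
α {m} zero    k = - sumℤ (map (λ j → cartan k j) (allFin m))
α {m} (suc j) k = cartan k j

-- pairing ⟨λ, α_i^∨⟩; α_0^∨ = -θ^∨ = -(α_1^∨ + ... + α_m^∨)
pair : ∀ {m} → Weight m → Fin (suc m) → ℤ
pair {m} λw zero    = - sumℤ (map λw (allFin m))
pair {m} λw (suc j) = λw j

refl-r : ∀ {m} → Fin (suc m) → Weight m → Weight m
refl-r i λw k = λw k - pair λw i * α i k

-- S = Sym(h*_Z): a polynomial is a formal Z-combination of products of weights
Monomial : ℕ → Set
Monomial m = ℤ × List (Weight m)

Poly : ℕ → Set
Poly m = List (Monomial m)

constTerm : ∀ {m} → Monomial m → ℤ
constTerm (c , [])    = c
constTerm (c , _ ∷ _) = + 0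

evalAt0 : ∀ {m} → Poly m → ℤ
evalAt0 s = sumℤ (map constTerm s)

-- Affine symmetric group via windows [w(1),...,w(n)], n = suc m

Word : ℕ → Set
Word m = List (Fin (suc m))

Window : ℕ → Set
Window m = Vec ℤ (suc m)

idWindow : ∀ {m} → Window m
idWindow = tabulate (λ p → + suc (toℕ p))

private
  _==_ : ∀ {k} → Fin k → Fin k → Bool
  a == b = does (a ≟ b)

-- w(i) < w(i+1) (ascent at i), i.e. ℓ(w r_i) > ℓ(w)
ascent : ∀ {m} → Window m → Fin (suc m) → Bool
ascent {m} w zero    = ⌊ lookup w (fromℕ m) - + suc m <? lookup w zero ⌋
ascent {m} w (suc j) = ⌊ lookup w (inject₁ j) <? lookup w (suc j) ⌋

rmul : ∀ {m} → Window m → Fin (suc m) → Window m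
rmul {m} w zero = tabulate λ p →
  if p == zero then lookup w (fromℕ m) - + suc m
  else if p == fromℕ m then lookup w zero + + suc m
  else lookup w p
rmul {m} w (suc j) = tabulate λ p →
  if p == inject₁ j then lookup w (suc j)
  else if p == suc j then lookup w (inject₁ j)
  else lookup w p

-- value of A_{a_1}⋯A_{a_k} : just w if the word is reduced (w = r_{a_1}⋯r_{a_k}), nothing (i.e. 0) otherwise
evalFrom : ∀ {m} → Window m → Word m → Maybe (Window m)
evalFrom w []      = just w
evalFrom w (a ∷ u) = if ascent w a then evalFrom (rmul w a) u else nothing

evalWord : ∀ {m} → Word m → Maybe (Window m)
evalWord = evalFrom idWindow

-- Affine nilCoxeter algebra A_0: formal Z-combinations of words A_{a_1}⋯A_{a_k}

Elem0 : ℕ → Set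
Elem0 m = List (ℤ × Word m)

coeff : ∀ {m} → Elem0 m → Window m → ℤ
coeff x w = sumℤ (map (λ { (c , u) → if does (MaybeP.≡-dec (VecP.≡-dec ℤ._≟_) (evalWord u) (just w)) then c else + 0 }) x)

_≈₀_ : ∀ {m} → Elem0 m → Elem0 m → Set
x ≈₀ y = ∀ w → coeff x w ≡ coeff y w

add0 : ∀ {m} → Elem0 m → Elem0 m → Elem0 m
add0 = List._++_

mul0 : ∀ {m} → Elem0 m → Elem0 m → Elem0 m
mul0 x y = concatMap (λ { (c , u) → map (λ { (d , v) → (c * d , u List.++ v) }) y }) x

scale0 : ∀ {m} → ℤ → Elem0 m → Elem0 m
scale0 k = map (λ { (c , u) → (k * c , u) })

sucMod : ∀ {m} → Fin (suc m) → Fin (suc m)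
sucMod {m} i = suc (toℕ i) mod suc m

elemOf : ∀ {m} → Fin (suc m) → Word m → Bool
elemOf a u = any (_== a) u

cycDec : ∀ {m} → Word m → Bool
cycDec []      = true
cycDec (a ∷ u) = not (elemOf a u) ∧ not (elemOf (sucMod a) u) ∧ cycDec u

allWords : ∀ {m} → ℕ → List (Word m)
allWords {m} zero    = [] ∷ []
allWords {m} (suc k) = concatMap (λ a → map (a ∷_) (allWords k)) (allFin (suc m))

-- one (reduced) cyclically decreasing word for each cyclically decreasing element of length k
cycDecWords : ∀ {m} → ℕ → List (Word m)
cycDecWords {m} k =
  deduplicate (λ u v → MaybeP.≡-dec (VecP.≡-dec ℤ._≟_) (evalWord u) (evalWord v))
    (filter (λ u → T? (cycDec u ∧ is-just (evalWord u))) (allWords k))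

h : ∀ {m} → Fin (suc m) → Elem0 m
h i = map (λ u → (+ 1 , u)) (cycDecWords (toℕ i))

-- expressions for elements of the subalgebra B generated by h_0,...,h_{n-1}
data BExpr (m : ℕ) : Set where
  gen  : Fin (suc m) → BExpr m
  one  : BExpr m
  _⊕_  : BExpr m → BExpr m → BExpr m
  _⊗_  : BExpr m → BExpr m → BExpr m
  neg  : BExpr m → BExpr m

⟦_⟧ : ∀ {m} → BExpr m → Elem0 m
⟦ gen i ⟧ = h i
⟦ one ⟧ = (+ 1 , []) ∷ []
⟦ e ⊕ f ⟧ = add0 ⟦ e ⟧ ⟦ f ⟧
⟦ e ⊗ f ⟧ = mul0 ⟦ e ⟧ ⟦ f ⟧
⟦ neg e ⟧ = scale0 (- + 1) ⟦ e ⟧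

-- Affine nilHecke ring: formal sums  Σ (monomial) · A_word, products computed
-- with the relation A_i λ = (r_i λ) A_i + ⟨λ, α_i^∨⟩.

ElemAff : ℕ → Set
ElemAff m = List (Monomial m × Word m)

-- A_i · λ_1⋯λ_k = Σ c · μ_1⋯μ_l · (A_i or 1)   (Bool: whether A_i remains)
pushGen : ∀ {m} → Fin (suc m) → List (Weight m) → List (ℤ × List (Weight m) × Bool)
pushGen i []        = (+ 1 , [] , true) ∷ []
pushGen i (λw ∷ ms) =
  (pair λw i , ms , false) ∷ map (λ { (c , ms' , b) → (c , refl-r i λw ∷ ms' , b) }) (pushGen i ms)

pushWord : ∀ {m} → Word m → Monomial m → ElemAff m
pushWord [] t = (t , []) ∷ []
pushWord (i ∷ u) t =
  concatMap (λ { ((c , ms) , v) →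
      map (λ { (d , ms' , b) → ((c * d , ms') , (if b then i ∷ v else v)) }) (pushGen i ms) })
    (pushWord u t)

mulAS : ∀ {m} → Elem0 m → Poly m → ElemAff m
mulAS x s = concatMap (λ { (c , u) → concatMap (λ { (d , ms) → pushWord u (c * d , ms) }) s }) x

φ₀ : ∀ {m} → ElemAff m → Elem0 m
φ₀ = map (λ { (t , u) → (constTerm t , u) })

-- Since φ₀ is linear and φ₀(x A_w) = φ₀(x) A_w, the elements a with φ₀(a s) = φ₀(s) a form a
-- subalgebra of A₀, so it suffices to treat the generators h_i. By the same identity only
-- φ₀(h_i λ) for a single weight λ matters, and it collects the terms of A_w λ in which λ is absorbed
-- by one letter a of w. For w cyclically decreasing with letter set S, the coefficient produced is
-- ⟨λ, α_a^∨ + α_{a−1}^∨ + ⋯⟩ along the run a − 1, a − 2, … inside S, and A_w becomes A_v with v the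
-- cyclically decreasing element with letters B = S ∖ {a}. Grouping by B, the coefficient of A_v is
-- a sum over a ∉ B of such run sums; as B misses a letter, every coroot α_b^∨ occurs exactly once,
-- and Σ_b α_b^∨ = 0.

module Submission where

open import Defs
open import Data.Nat as ℕ using (ℕ; zero; suc; z≤n; s≤s; _≤_; _∸_)
import Data.Nat.Properties as ℕP
open import Data.Nat.DivMod using (_%_; m<n⇒m%n≡m; n%n≡0)
open import Data.Integer as ℤ using (ℤ; +_; _+_; _-_; _*_; -_; _<?_; +≤+; +<+)
import Data.Integer.Properties as ℤP
open import Data.Integer.Solver using (module +-*-Solver)
open import Data.Fin as Fin using (Fin; zero; suc; toℕ; inject₁; fromℕ)
import Data.Fin.Properties as FinP
open import Data.Bool using (Bool; true; false; if_then_else_; _∧_; _∨_; not; T)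
import Data.Bool.Properties as BP
open import Data.Bool.ListAction using (any)
open import Data.Maybe using (Maybe; just; nothing; is-just; _>>=_)
import Data.Maybe.Properties as MaybeP
open import Data.Vec as Vec using (Vec; []; _∷_; lookup; tabulate; _[_]≔_)
import Data.Vec.Properties as VecP
open import Data.List as List using (List; []; _∷_; map; concatMap; _++_; allFin; length; filter; deduplicate)
import Data.List.Properties as LP
open import Data.List.Relation.Unary.All as All using (All; []; _∷_)
open import Data.List.Relation.Binary.Pointwise as Pointwise using (Pointwise; []; _∷_)
open import Data.List.Relation.Unary.Any using (here; there)
open import Data.List.Membership.Propositional using (_∈_)
import Data.List.Membership.Propositional.Properties as MemP
import Data.List.Relation.Unary.All.Properties as AllP
open import Data.Product using (_×_; _,_; proj₁; proj₂; Σ)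
open import Data.Sum using (_⊎_; inj₁; inj₂)
open import Data.Empty using (⊥; ⊥-elim)
open import Data.Unit using (⊤; tt)
open import Relation.Nullary using (¬_; Dec; yes; no; does; ¬?)
open import Relation.Nullary.Decidable using (⌊_⌋; T?; dec-true; dec-false)
open import Relation.Unary using (Pred; Decidable)
import Relation.Binary as B
open import Relation.Binary.PropositionalEquality
open import Function using (_∘_)
import Level
open import Algebra.Bundles using (AbelianGroup)
open import Algebra.Properties.CommutativeSemigroup ℤP.+-commutativeSemigroup
  using () renaming (interchange to +-interchange; x∙yz≈y∙xz to +-left-comm)
open import Algebra.Properties.CommutativeSemigroup ℤP.*-commutativeSemigroup
  using () renaming (x∙yz≈y∙xz to *-left-comm)
open import Algebra.Properties.Group (AbelianGroup.group ℤP.+-0-abelianGroup)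
  using () renaming (∙-cancelʳ to +-cancelʳ)

indicator : Bool → ℤ
indicator true = + 1
indicator false = + 0

module Sums where

  ∑ : ∀ {a} {A : Set a} → (A → ℤ) → List A → ℤ
  ∑ f xs = sumℤ (map f xs)

  module _ {a} {A : Set a} where

    ∑-++ : ∀ (f : A → ℤ) xs ys → ∑ f (xs ++ ys) ≡ ∑ f xs + ∑ f ys
    ∑-++ f [] ys = sym (ℤP.+-identityˡ _)
    ∑-++ f (x ∷ xs) ys = trans (cong (_+_ (f x)) (∑-++ f xs ys)) (sym (ℤP.+-assoc (f x) _ _))

    ∑-cong : ∀ {f g : A → ℤ} xs → (∀ x → f x ≡ g x) → ∑ f xs ≡ ∑ g xs
    ∑-cong [] e = refl
    ∑-cong (x ∷ xs) e = cong₂ _+_ (e x) (∑-cong xs e)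

    ∑-cong-All : ∀ {P : A → Set} {f g : A → ℤ} xs → All P xs → (∀ x → P x → f x ≡ g x) → ∑ f xs ≡ ∑ g xs
    ∑-cong-All [] [] e = refl
    ∑-cong-All (x ∷ xs) (px ∷ pxs) e = cong₂ _+_ (e x px) (∑-cong-All xs pxs e)

    ∑-zero : ∀ (xs : List A) → ∑ (λ _ → + 0) xs ≡ + 0
    ∑-zero [] = refl
    ∑-zero (x ∷ xs) = trans (ℤP.+-identityˡ _) (∑-zero xs)

    ∑-+ : ∀ (f g : A → ℤ) xs → ∑ (λ x → f x + g x) xs ≡ ∑ f xs + ∑ g xs
    ∑-+ f g [] = refl
    ∑-+ f g (x ∷ xs) = trans (cong (_+_ (f x + g x)) (∑-+ f g xs)) (+-interchange (f x) (g x) _ _)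

    ∑-* : ∀ (c : ℤ) (f : A → ℤ) xs → ∑ (λ x → c * f x) xs ≡ c * ∑ f xs
    ∑-* c f [] = sym (ℤP.*-zeroʳ c)
    ∑-* c f (x ∷ xs) = trans (cong (_+_ (c * f x)) (∑-* c f xs)) (sym (ℤP.*-distribˡ-+ c (f x) _))

    ∑-*ʳ : ∀ (c : ℤ) (f : A → ℤ) xs → ∑ (λ x → f x * c) xs ≡ ∑ f xs * c
    ∑-*ʳ c f [] = refl
    ∑-*ʳ c f (x ∷ xs) = trans (cong (_+_ (f x * c)) (∑-*ʳ c f xs)) (sym (ℤP.*-distribʳ-+ c (f x) _))

    ∑-filter : ∀ {P : Pred A Level.zero} (P? : Decidable P) (f : A → ℤ) xs →
      ∑ f (filter P? xs) ≡ ∑ (λ x → indicator (does (P? x)) * f x) xs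
    ∑-filter P? f [] = refl
    ∑-filter P? f (x ∷ xs) with does (P? x)
    ... | true = cong₂ _+_ (sym (ℤP.*-identityˡ (f x))) (∑-filter P? f xs)
    ... | false = trans (∑-filter P? f xs) (sym (ℤP.+-identityˡ _))

  module _ {a b} {A : Set a} {B : Set b} where

    ∑-map : ∀ (f : B → ℤ) (g : A → B) xs → ∑ f (map g xs) ≡ ∑ (f ∘ g) xs
    ∑-map f g [] = refl
    ∑-map f g (x ∷ xs) = cong (_+_ (f (g x))) (∑-map f g xs)

    ∑-concatMap : ∀ (f : B → ℤ) (g : A → List B) xs → ∑ f (concatMap g xs) ≡ ∑ (λ x → ∑ f (g x)) xs
    ∑-concatMap f g [] = refl
    ∑-concatMap f g (x ∷ xs) = trans (∑-++ f (g x) (concatMap g xs)) (cong (_+_ (∑ f (g x))) (∑-concatMap f g xs))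

    ∑-swap : ∀ (f : A → B → ℤ) xs ys → ∑ (λ x → ∑ (f x) ys) xs ≡ ∑ (λ y → ∑ (λ x → f x y) xs) ys
    ∑-swap f [] ys = sym (∑-zero ys)
    ∑-swap f (x ∷ xs) ys =
      trans (cong (_+_ (∑ (f x) ys)) (∑-swap f xs ys)) (sym (∑-+ (f x) (λ y → ∑ (λ x → f x y) xs) ys))

  ∑Fin : ∀ {n} → (Fin n → ℤ) → ℤ
  ∑Fin {zero} f = + 0
  ∑Fin {suc n} f = f zero + ∑Fin (f ∘ suc)

  ∑-allFin : ∀ {n} (f : Fin n → ℤ) → ∑ f (allFin n) ≡ ∑Fin f
  ∑-allFin f = go f (λ x → x)
    where
    go : ∀ {n} {A : Set} (f : A → ℤ) (g : Fin n → A) → ∑ f (List.tabulate g) ≡ ∑Fin (f ∘ g)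
    go {zero} f g = refl
    go {suc n} f g = cong (_+_ (f (g zero))) (go f (g ∘ suc))

  ∑Fin-cong : ∀ {n} {f g : Fin n → ℤ} → (∀ x → f x ≡ g x) → ∑Fin f ≡ ∑Fin g
  ∑Fin-cong {zero} e = refl
  ∑Fin-cong {suc n} e = cong₂ _+_ (e zero) (∑Fin-cong (e ∘ suc))

  ∑Fin-+ : ∀ {n} (f g : Fin n → ℤ) → ∑Fin (λ x → f x + g x) ≡ ∑Fin f + ∑Fin g
  ∑Fin-+ {zero} f g = refl
  ∑Fin-+ {suc n} f g = trans (cong (_+_ (f zero + g zero)) (∑Fin-+ (f ∘ suc) (g ∘ suc))) (+-interchange (f zero) (g zero) _ _)

  ∑Fin-* : ∀ {n} (c : ℤ) (f : Fin n → ℤ) → ∑Fin (λ x → c * f x) ≡ c * ∑Fin f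
  ∑Fin-* {zero} c f = sym (ℤP.*-zeroʳ c)
  ∑Fin-* {suc n} c f = trans (cong (_+_ (c * f zero)) (∑Fin-* c (f ∘ suc))) (sym (ℤP.*-distribˡ-+ c _ _))

  ∑Fin-neg : ∀ {n} (f : Fin n → ℤ) → ∑Fin (λ x → - f x) ≡ - ∑Fin f
  ∑Fin-neg {zero} f = refl
  ∑Fin-neg {suc n} f = trans (cong (_+_ (- f zero)) (∑Fin-neg (f ∘ suc))) (sym (ℤP.neg-distrib-+ (f zero) _))

  ∑Fin-last : ∀ {n} (g : Fin (suc n) → ℤ) → ∑Fin g ≡ ∑Fin (g ∘ inject₁) + g (fromℕ n)
  ∑Fin-last {zero} g = trans (ℤP.+-identityʳ (g zero)) (sym (ℤP.+-identityˡ (g zero)))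
  ∑Fin-last {suc n} g = trans (cong (_+_ (g zero)) (∑Fin-last (g ∘ suc))) (sym (ℤP.+-assoc (g zero) _ _))


module Expansion where

  open Sums

  -- Recursive forms of the sums  Σ c · K ms' b  over  pushGen i ms  and  Σ c · F ms' v  over
  -- pushWord u (1 , ms)  (see ∑-pushGen, ∑-pushWord): unlike the lists, they can be rearranged
  -- by congruence and linearity.
  module _ {m : ℕ} where
    private Ws = List (Weight m)

    PushGen : Fin (suc m) → Ws → (Ws → Bool → ℤ) → ℤ
    PushGen i [] K = K [] true
    PushGen i (l ∷ ms) K = pair l i * K ms false + PushGen i ms (λ ms' b → K (refl-r i l ∷ ms') b)

    consIf : Bool → Fin (suc m) → Word m → Word m
    consIf b i v = if b then i ∷ v else v

    consIf-++ : ∀ b i (v w : Word m) → consIf b i (v ++ w) ≡ consIf b i v ++ w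
    consIf-++ true i v w = refl
    consIf-++ false i v w = refl

    PushWord : Word m → Ws → (Ws → Word m → ℤ) → ℤ
    PushWord [] ms F = F ms []
    PushWord (i ∷ u) ms F = PushWord u ms (λ ms' v → PushGen i ms' (λ ms'' b → F ms'' (consIf b i v)))

    ∑-pushGen : ∀ i ms K → ∑ (λ { (d , ms' , b) → d * K ms' b }) (pushGen i ms) ≡ PushGen i ms K
    ∑-pushGen i [] K = trans (ℤP.+-identityʳ _) (ℤP.*-identityˡ _)
    ∑-pushGen i (l ∷ ms) K = cong (_+_ (pair l i * K ms false))
      (trans (∑-map _ _ (pushGen i ms)) (∑-pushGen i ms (λ ms' b → K (refl-r i l ∷ ms') b)))

    ∑-pushWord : ∀ u (k : ℤ) ms F → ∑ (λ { ((c , ms') , v) → c * F ms' v }) (pushWord u (k , ms)) ≡ k * PushWord u ms F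
    ∑-pushWord [] k ms F = ℤP.+-identityʳ _
    ∑-pushWord (i ∷ u) k ms F =
      trans (∑-concatMap _ _ (pushWord u (k , ms)))
      (trans (∑-cong (pushWord u (k , ms)) term)
      (∑-pushWord u k ms _))
      where
      term : ∀ (t : Monomial m × Word m) → _
      term ((c , ms') , v) =
        trans (∑-map _ _ (pushGen i ms'))
        (trans (∑-cong (pushGen i ms') (λ x → ℤP.*-assoc c (proj₁ x) _))
        (trans (∑-* c _ (pushGen i ms'))
        (cong (c *_) (∑-pushGen i ms' _))))

    PushGen-cong : ∀ i ms {K K'} → (∀ a b → K a b ≡ K' a b) → PushGen i ms K ≡ PushGen i ms K'
    PushGen-cong i [] e = e [] true
    PushGen-cong i (l ∷ ms) e = cong₂ _+_ (cong (pair l i *_) (e ms false)) (PushGen-cong i ms (λ a b → e _ b))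

    PushWord-cong : ∀ u ms {F F'} → (∀ a v → F a v ≡ F' a v) → PushWord u ms F ≡ PushWord u ms F'
    PushWord-cong [] ms e = e ms []
    PushWord-cong (i ∷ u) ms e = PushWord-cong u ms (λ a v → PushGen-cong i a (λ a' b → e a' _))

    PushGen-+ : ∀ i ms K K' → PushGen i ms (λ a b → K a b + K' a b) ≡ PushGen i ms K + PushGen i ms K'
    PushGen-+ i [] K K' = refl
    PushGen-+ i (l ∷ ms) K K' =
      trans (cong₂ _+_ (ℤP.*-distribˡ-+ (pair l i) (K ms false) (K' ms false))
                       (PushGen-+ i ms (λ a b → K (refl-r i l ∷ a) b) (λ a b → K' (refl-r i l ∷ a) b)))
            (+-interchange (pair l i * K ms false) (pair l i * K' ms false) _ _)

    PushGen-* : ∀ i ms c K → PushGen i ms (λ a b → c * K a b) ≡ c * PushGen i ms K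
    PushGen-* i [] c K = refl
    PushGen-* i (l ∷ ms) c K =
      trans (cong₂ _+_ (*-left-comm (pair l i) c (K ms false)) (PushGen-* i ms c (λ a b → K (refl-r i l ∷ a) b)))
        (sym (ℤP.*-distribˡ-+ c (pair l i * K ms false) _))

    PushGen-zero : ∀ i ms → PushGen i ms (λ _ _ → + 0) ≡ + 0
    PushGen-zero i [] = refl
    PushGen-zero i (l ∷ ms) = cong₂ _+_ (ℤP.*-zeroʳ (pair l i)) (PushGen-zero i ms)

    PushWord-+ : ∀ u ms F F' → PushWord u ms (λ a b → F a b + F' a b) ≡ PushWord u ms F + PushWord u ms F'
    PushWord-+ [] ms F F' = refl
    PushWord-+ (i ∷ u) ms F F' = trans (PushWord-cong u ms (λ a v → PushGen-+ i a _ _)) (PushWord-+ u ms _ _)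

    PushWord-* : ∀ u ms c F → PushWord u ms (λ a b → c * F a b) ≡ c * PushWord u ms F
    PushWord-* [] ms c F = refl
    PushWord-* (i ∷ u) ms c F = trans (PushWord-cong u ms (λ a v → PushGen-* i a c _)) (PushWord-* u ms c _)

    PushWord-zero : ∀ u ms → PushWord u ms (λ _ _ → + 0) ≡ + 0
    PushWord-zero [] ms = refl
    PushWord-zero (i ∷ u) ms = trans (PushWord-cong u ms (λ a v → PushGen-zero i a)) (PushWord-zero u ms)

    PushWord-∑ : ∀ {a} {A : Set a} u ms (g : A → Ws → Word m → ℤ) xs →
      PushWord u ms (λ p q → ∑ (λ x → g x p q) xs) ≡ ∑ (λ x → PushWord u ms (g x)) xs
    PushWord-∑ u ms g [] = PushWord-zero u ms
    PushWord-∑ u ms g (x ∷ xs) = trans (PushWord-+ u ms _ _) (cong (_+_ (PushWord u ms (g x))) (PushWord-∑ u ms g xs))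

    PushWord-const : ∀ u F → PushWord u [] F ≡ F [] u
    PushWord-const [] F = refl
    PushWord-const (i ∷ u) F = PushWord-const u _

    PushWord-++ : ∀ u₁ u₂ ms F →
      PushWord (u₁ ++ u₂) ms F ≡ PushWord u₂ ms (λ ms₂ v₂ → PushWord u₁ ms₂ (λ ms₁ v₁ → F ms₁ (v₁ ++ v₂)))
    PushWord-++ [] u₂ ms F = refl
    PushWord-++ (i ∷ u₁) u₂ ms F =
      trans (PushWord-++ u₁ u₂ ms _)
        (PushWord-cong u₂ ms (λ a v → PushWord-cong u₁ a (λ a' v' → PushGen-cong i a' (λ a'' b → cong (F a'') (consIf-++ b i v' v)))))

    PushWord-PushGen : ∀ v ms i ms₁ (Q : Ws → Bool → Ws → Word m → ℤ) →
      PushWord v ms (λ a w → PushGen i ms₁ (λ c b → Q c b a w)) ≡ PushGen i ms₁ (λ c b → PushWord v ms (Q c b))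
    PushWord-PushGen v ms i [] Q = refl
    PushWord-PushGen v ms i (l ∷ ms₁) Q =
      trans (PushWord-+ v ms _ _) (cong₂ _+_ (PushWord-* v ms (pair l i) _) (PushWord-PushGen v ms i ms₁ _))

    PushGen-++ʷ : ∀ i ms₁ ms₂ H → PushGen i (ms₁ ++ ms₂) H ≡
      PushGen i ms₁ (λ ms₁' b → if b then PushGen i ms₂ (λ ms₂' b' → H (ms₁' ++ ms₂') b') else H (ms₁' ++ ms₂) false)
    PushGen-++ʷ i [] ms₂ H = refl
    PushGen-++ʷ i (l ∷ ms₁) ms₂ H = cong (_+_ (pair l i * H (ms₁ ++ ms₂) false))
      (trans (PushGen-++ʷ i ms₁ ms₂ _) (PushGen-cong i ms₁ (λ { a true → refl ; a false → refl })))

    PushWord-++ʷ : ∀ u ms₀ ms F → PushWord u (ms₀ ++ ms) F ≡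
      PushWord u ms₀ (λ ms₁ v → PushWord v ms (λ ms₂ v₂ → F (ms₁ ++ ms₂) v₂))
    PushWord-++ʷ [] ms₀ ms F = refl
    PushWord-++ʷ (i ∷ u) ms₀ ms F =
      trans (PushWord-++ʷ u ms₀ ms _) (PushWord-cong u ms₀ λ ms₁ v →
        trans (PushWord-cong v ms (λ ms₂ v₂ → PushGen-++ʷ i ms₁ ms₂ _))
        (trans (PushWord-PushGen v ms i ms₁ _)
        (PushGen-cong i ms₁ (λ { a true → refl ; a false → refl }))))


module SingleWeight where

  open Expansion

  module _ {m : ℕ} where

    reflectAll : Word m → Weight m → Weight m
    reflectAll [] l = l
    reflectAll (i ∷ u) l = refl-r i (reflectAll u l)

    -- The part of  A_u · λ  in which λ has been absorbed: the letter u_j is deleted and contributes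
    -- ⟨r_{u_{j+1}} ⋯ r_{u_k} λ , α_{u_j}^∨⟩.
    absorb : Word m → Weight m → (Word m → ℤ) → ℤ
    absorb [] l K = + 0
    absorb (i ∷ u) l K = absorb u l (λ v → K (i ∷ v)) + pair (reflectAll u l) i * K u

    PushWord-single : ∀ u l K → PushWord u (l ∷ []) K ≡ absorb u l (λ v → K [] v) + K (reflectAll u l ∷ []) u
    PushWord-single [] l K = sym (ℤP.+-identityˡ _)
    PushWord-single (i ∷ u) l K = trans (PushWord-single u l _)
      (sym (ℤP.+-assoc (absorb u l (λ v → K [] (i ∷ v))) _ _))


module Commutant where

  open Sums
  open Expansion

  module _ {m : ℕ} where

    ⟨_∣_⟩ : Elem0 m → (Word m → ℤ) → ℤ
    ⟨ x ∣ f ⟩ = ∑ (λ cu → proj₁ cu * f (proj₂ cu)) x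

    ⟨⟩-cong : ∀ x {f g : Word m → ℤ} → (∀ u → f u ≡ g u) → ⟨ x ∣ f ⟩ ≡ ⟨ x ∣ g ⟩
    ⟨⟩-cong x e = ∑-cong x (λ cu → cong (proj₁ cu *_) (e (proj₂ cu)))

    ⟨⟩-* : ∀ x c (f : Word m → ℤ) → ⟨ x ∣ (λ u → c * f u) ⟩ ≡ c * ⟨ x ∣ f ⟩
    ⟨⟩-* x c f = trans (∑-cong x (λ cu → *-left-comm (proj₁ cu) c _)) (∑-* c _ x)

    ⟨⟩-zero : ∀ x → ⟨ x ∣ (λ _ → + 0) ⟩ ≡ + 0
    ⟨⟩-zero x = trans (∑-cong x (λ cu → ℤP.*-zeroʳ (proj₁ cu))) (∑-zero x)

    ⟨add0⟩ : ∀ x y (f : Word m → ℤ) → ⟨ add0 x y ∣ f ⟩ ≡ ⟨ x ∣ f ⟩ + ⟨ y ∣ f ⟩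
    ⟨add0⟩ x y f = ∑-++ _ x y

    ⟨scale0⟩ : ∀ k x (f : Word m → ℤ) → ⟨ scale0 k x ∣ f ⟩ ≡ k * ⟨ x ∣ f ⟩
    ⟨scale0⟩ k x f = trans (∑-map _ _ x) (trans (∑-cong x (λ cu → ℤP.*-assoc k (proj₁ cu) _)) (∑-* k _ x))

    ⟨mul0⟩ : ∀ x y (f : Word m → ℤ) → ⟨ mul0 x y ∣ f ⟩ ≡ ⟨ x ∣ (λ u → ⟨ y ∣ (λ v → f (u ++ v)) ⟩) ⟩
    ⟨mul0⟩ x y f = trans (∑-concatMap _ _ x) (∑-cong x (λ cu →
      trans (∑-map _ _ y) (trans (∑-cong y (λ dv → ℤP.*-assoc (proj₁ cu) (proj₁ dv) _)) (∑-* (proj₁ cu) _ y))))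

    ⟨⟩-swap : ∀ x y (f : Word m → Word m → ℤ) →
      ⟨ x ∣ (λ u → ⟨ y ∣ f u ⟩) ⟩ ≡ ⟨ y ∣ (λ v → ⟨ x ∣ (λ u → f u v) ⟩) ⟩
    ⟨⟩-swap x y f =
      trans (∑-cong x (λ cu → sym (⟨⟩-* y (proj₁ cu) (f (proj₂ cu)))))
      (trans (∑-swap _ x y)
      (∑-cong y (λ dv → ∑-* (proj₁ dv) _ x)))

    ⟨⟩-PushWord : ∀ x v ms (g : Word m → List (Weight m) → Word m → ℤ) →
      PushWord v ms (λ a b → ⟨ x ∣ (λ u → g u a b) ⟩) ≡ ⟨ x ∣ (λ u → PushWord v ms (g u)) ⟩
    ⟨⟩-PushWord x v ms g =
      trans (PushWord-∑ v ms _ x) (∑-cong x (λ cu → PushWord-* v ms (proj₁ cu) _))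

    prodAt0 : List (Weight m) → ℤ
    prodAt0 [] = + 1
    prodAt0 (_ ∷ _) = + 0

    -- G paired with φ₀(A_u · λ₁⋯λₖ), the basis being translated by W₀ (A_v ↦ A_{W₀ v})
    φ₀At : Word m → List (Weight m) → Window m → (Maybe (Window m) → ℤ) → ℤ
    φ₀At u ms W₀ G = PushWord u ms (λ ms' v → prodAt0 ms' * G (evalFrom W₀ v))

    -- Membership in B′, tested against every functional G on basis elements (vanishing on the
    -- zero value nothing) and after translation of the basis by every W₀; the translation makes
    -- the predicate closed under products.
    InB′ : Elem0 m → Set
    InB′ x = ∀ W₀ (G : Maybe (Window m) → ℤ) → G nothing ≡ + 0 → ∀ ms →
      ⟨ x ∣ (λ u → φ₀At u ms W₀ G) ⟩ ≡ prodAt0 ms * ⟨ x ∣ (λ u → G (evalFrom W₀ u)) ⟩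

    evalFrom-++ : ∀ W (u v : Word m) → evalFrom W (u ++ v) ≡ (evalFrom W u >>= λ W' → evalFrom W' v)
    evalFrom-++ W [] v = refl
    evalFrom-++ W (a ∷ u) v with ascent W a
    ... | true = evalFrom-++ (rmul W a) u v
    ... | false = refl

    InB′-one : InB′ ((+ 1 , []) ∷ [])
    InB′-one W₀ G G0 ms = trans (ℤP.+-identityʳ _) (trans (ℤP.*-identityˡ _)
      (sym (cong (prodAt0 ms *_) (trans (ℤP.+-identityʳ _) (ℤP.*-identityˡ _)))))

    InB′-add0 : ∀ x y → InB′ x → InB′ y → InB′ (add0 x y)
    InB′-add0 x y x∈ y∈ W₀ G G0 ms =
      trans (⟨add0⟩ x y _) (trans (cong₂ _+_ (x∈ W₀ G G0 ms) (y∈ W₀ G G0 ms))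
        (trans (sym (ℤP.*-distribˡ-+ (prodAt0 ms) _ _)) (cong (prodAt0 ms *_) (sym (⟨add0⟩ x y _)))))

    InB′-scale0 : ∀ k x → InB′ x → InB′ (scale0 k x)
    InB′-scale0 k x x∈ W₀ G G0 ms =
      trans (⟨scale0⟩ k x _) (trans (cong (k *_) (x∈ W₀ G G0 ms))
        (trans (*-left-comm k (prodAt0 ms) _) (cong (prodAt0 ms *_) (sym (⟨scale0⟩ k x _)))))

    φ₀At-++ : ∀ u v ms W₀ G →
      φ₀At (u ++ v) ms W₀ G ≡ PushWord v ms (λ a b → φ₀At u a W₀ (λ mW → G (mW >>= λ W → evalFrom W b)))
    φ₀At-++ u v ms W₀ G = trans (PushWord-++ u v ms _)
      (PushWord-cong v ms (λ a b → PushWord-cong u a (λ a' b' → cong (λ z → prodAt0 a' * G z) (evalFrom-++ W₀ b' b))))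

    InB′-mul0 : ∀ x y → InB′ x → InB′ y → InB′ (mul0 x y)
    InB′-mul0 x y x∈ y∈ W₀ G G0 ms = begin
      ⟨ mul0 x y ∣ (λ w → φ₀At w ms W₀ G) ⟩
        ≡⟨ trans (⟨mul0⟩ x y _) (⟨⟩-swap x y _) ⟩
      ⟨ y ∣ (λ v → ⟨ x ∣ (λ u → φ₀At (u ++ v) ms W₀ G) ⟩) ⟩
        ≡⟨ ⟨⟩-cong y (λ v → trans (⟨⟩-cong x (λ u → φ₀At-++ u v ms W₀ G)) (sym (⟨⟩-PushWord x v ms _))) ⟩
      ⟨ y ∣ (λ v → PushWord v ms (λ a b → ⟨ x ∣ (λ u → φ₀At u a W₀ (G-after b)) ⟩)) ⟩
        ≡⟨ ⟨⟩-cong y (λ v → PushWord-cong v ms (λ a b → x∈ W₀ (G-after b) G0 a)) ⟩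
      ⟨ y ∣ (λ v → PushWord v ms (λ a b → prodAt0 a * ⟨ x ∣ (λ u → G-after b (evalFrom W₀ u)) ⟩)) ⟩
        ≡⟨ ⟨⟩-cong y (λ v → trans (PushWord-cong v ms (λ a b → sym (⟨⟩-* x (prodAt0 a) _))) (⟨⟩-PushWord x v ms _)) ⟩
      ⟨ y ∣ (λ v → ⟨ x ∣ (λ u → φ₀From (evalFrom W₀ u) v) ⟩) ⟩
        ≡⟨ ⟨⟩-swap y x _ ⟩
      ⟨ x ∣ (λ u → ⟨ y ∣ (λ v → φ₀From (evalFrom W₀ u) v) ⟩) ⟩
        ≡⟨ ⟨⟩-cong x (λ u → y-after u) ⟩
      ⟨ x ∣ (λ u → prodAt0 ms * ⟨ y ∣ (λ v → G (evalFrom W₀ (u ++ v))) ⟩) ⟩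
        ≡⟨ trans (⟨⟩-* x (prodAt0 ms) _) (cong (prodAt0 ms *_) (sym (⟨mul0⟩ x y _))) ⟩
      prodAt0 ms * ⟨ mul0 x y ∣ (λ w → G (evalFrom W₀ w)) ⟩ ∎
      where
      open ≡-Reasoning
      G-after : Word m → Maybe (Window m) → ℤ
      G-after b mW = G (mW >>= λ W → evalFrom W b)

      φ₀From : Maybe (Window m) → Word m → ℤ
      φ₀From mW v = PushWord v ms (λ a b → prodAt0 a * G-after b mW)

      φ₀From-nothing : ∀ v → φ₀From nothing v ≡ + 0
      φ₀From-nothing v = trans (PushWord-cong v ms (λ a b → trans (cong (prodAt0 a *_) G0) (ℤP.*-zeroʳ (prodAt0 a))))
                             (PushWord-zero v ms)

      y-after : ∀ u → ⟨ y ∣ (λ v → φ₀From (evalFrom W₀ u) v) ⟩ ≡ prodAt0 ms * ⟨ y ∣ (λ v → G (evalFrom W₀ (u ++ v))) ⟩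
      y-after u with evalFrom W₀ u | evalFrom-++ W₀ u
      ... | nothing | e = trans (⟨⟩-cong y φ₀From-nothing) (trans (⟨⟩-zero y) (sym (trans
            (cong (prodAt0 ms *_) (trans (⟨⟩-cong y (λ v → trans (cong G (e v)) G0)) (⟨⟩-zero y))) (ℤP.*-zeroʳ (prodAt0 ms)))))
      ... | just W₁ | e = trans (y∈ W₁ G G0 ms) (cong (prodAt0 ms *_) (⟨⟩-cong y (λ v → cong G (sym (e v)))))

    InB′-⟦⟧ : (∀ i → InB′ (h i)) → ∀ b → InB′ ⟦ b ⟧
    InB′-⟦⟧ h∈ (gen i) = h∈ i
    InB′-⟦⟧ h∈ one = InB′-one
    InB′-⟦⟧ h∈ (e ⊕ f) = InB′-add0 ⟦ e ⟧ ⟦ f ⟧ (InB′-⟦⟧ h∈ e) (InB′-⟦⟧ h∈ f)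
    InB′-⟦⟧ h∈ (e ⊗ f) = InB′-mul0 ⟦ e ⟧ ⟦ f ⟧ (InB′-⟦⟧ h∈ e) (InB′-⟦⟧ h∈ f)
    InB′-⟦⟧ h∈ (neg e) = InB′-scale0 (- + 1) ⟦ e ⟧ (InB′-⟦⟧ h∈ e)


module Coefficients where

  open Sums
  open Expansion
  open Commutant

  module _ {m : ℕ} (w : Window m) where

    isAt : Maybe (Window m) → ℤ
    isAt mW = if does (MaybeP.≡-dec (VecP.≡-dec ℤ._≟_) mW (just w)) then + 1 else + 0

    coeff-⟨⟩ : ∀ (x : Elem0 m) → coeff x w ≡ ⟨ x ∣ (λ u → isAt (evalWord u)) ⟩
    coeff-⟨⟩ x = ∑-cong x (λ cu → if-zero _ (proj₁ cu))
      where
      if-zero : ∀ (b : Bool) (c : ℤ) → (if b then c else + 0) ≡ c * (if b then + 1 else + 0)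
      if-zero true c = sym (ℤP.*-identityʳ c)
      if-zero false c = sym (ℤP.*-zeroʳ c)

    constTerm-prodAt0 : ∀ (t : Monomial m) → constTerm t ≡ proj₁ t * prodAt0 (proj₂ t)
    constTerm-prodAt0 (c , []) = sym (ℤP.*-identityʳ c)
    constTerm-prodAt0 (c , _ ∷ _) = sym (ℤP.*-zeroʳ c)

    coeff-φ₀-mulAS : ∀ x s → coeff (φ₀ (mulAS x s)) w ≡ ∑ (λ t → proj₁ t * ⟨ x ∣ (λ u → φ₀At u (proj₂ t) idWindow isAt) ⟩) s
    coeff-φ₀-mulAS x s =
      trans (coeff-⟨⟩ (φ₀ (mulAS x s)))
      (trans (∑-map _ _ (mulAS x s))
      (trans (∑-concatMap _ _ x)
      (trans (∑-cong x (λ cu → trans (∑-concatMap _ _ s) (∑-cong s (λ t → pushed (proj₁ cu) (proj₂ cu) t))))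
      (trans (∑-swap _ x s)
      (∑-cong s (λ t → ∑-* (proj₁ t) _ x))))))
      where
      pushed : ∀ c u t → ∑ (λ tv → constTerm (proj₁ tv) * isAt (evalWord (proj₂ tv))) (pushWord u (c * proj₁ t , proj₂ t))
                        ≡ proj₁ t * (c * φ₀At u (proj₂ t) idWindow isAt)
      pushed c u t =
        trans (∑-cong (pushWord u _) (λ tv → trans (cong (_* isAt (evalWord (proj₂ tv))) (constTerm-prodAt0 (proj₁ tv)))
                                                   (ℤP.*-assoc (proj₁ (proj₁ tv)) _ _)))
        (trans (∑-pushWord u (c * proj₁ t) (proj₂ t) _)
        (trans (cong (_* φ₀At u (proj₂ t) idWindow isAt) (ℤP.*-comm c (proj₁ t))) (ℤP.*-assoc (proj₁ t) c _)))

  InB′⇒commutes : ∀ {m} (x : Elem0 m) → InB′ x → ∀ s → φ₀ (mulAS x s) ≈₀ scale0 (evalAt0 s) x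
  InB′⇒commutes x x∈ s w = begin
    coeff (φ₀ (mulAS x s)) w
      ≡⟨ coeff-φ₀-mulAS w x s ⟩
    ∑ (λ t → proj₁ t * ⟨ x ∣ (λ u → φ₀At u (proj₂ t) idWindow (isAt w)) ⟩) s
      ≡⟨ ∑-cong s (λ t → cong (proj₁ t *_) (x∈ idWindow (isAt w) refl (proj₂ t))) ⟩
    ∑ (λ t → proj₁ t * (prodAt0 (proj₂ t) * term)) s
      ≡⟨ ∑-cong s (λ t → sym (ℤP.*-assoc (proj₁ t) (prodAt0 (proj₂ t)) term)) ⟩
    ∑ (λ t → proj₁ t * prodAt0 (proj₂ t) * term) s
      ≡⟨ ∑-cong s (λ t → cong (_* term) (sym (constTerm-prodAt0 w t))) ⟩
    ∑ (λ t → constTerm t * term) s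
      ≡⟨ ∑-*ʳ term constTerm s ⟩
    evalAt0 s * term
      ≡⟨ sym (⟨scale0⟩ (evalAt0 s) x (λ u → isAt w (evalWord u))) ⟩
    ⟨ scale0 (evalAt0 s) x ∣ (λ u → isAt w (evalWord u)) ⟩
      ≡⟨ sym (coeff-⟨⟩ w (scale0 (evalAt0 s) x)) ⟩
    coeff (scale0 (evalAt0 s) x) w ∎
    where
    open ≡-Reasoning
    term : ℤ
    term = ⟨ x ∣ (λ u → isAt w (evalWord u)) ⟩

module Cyclic where

  _==_ : ∀ {n} → Fin n → Fin n → Bool
  a == b = does (a FinP.≟ b)

  ==-refl : ∀ {n} (a : Fin n) → (a == a) ≡ true
  ==-refl a = dec-true (a FinP.≟ a) refl

  ==-≢ : ∀ {n} {a b : Fin n} → ¬ a ≡ b → (a == b) ≡ false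
  ==-≢ {a = a} {b} = dec-false (a FinP.≟ b)

  ==⇒≡ : ∀ {n} {a b : Fin n} → (a == b) ≡ true → a ≡ b
  ==⇒≡ {a = a} {b} e with a FinP.≟ b
  ... | yes a≡b = a≡b

  fromℕ⊎inject₁ : ∀ {m} (i : Fin (suc m)) → (i ≡ fromℕ m) ⊎ Σ (Fin m) (λ j → i ≡ inject₁ j)
  fromℕ⊎inject₁ {zero} zero = inj₁ refl
  fromℕ⊎inject₁ {suc m} zero = inj₂ (zero , refl)
  fromℕ⊎inject₁ {suc m} (suc i) with fromℕ⊎inject₁ i
  ... | inj₁ e = inj₁ (cong suc e)
  ... | inj₂ (j , e) = inj₂ (suc j , cong suc e)

  module _ {m : ℕ} where

    predMod : Fin (suc m) → Fin (suc m)
    predMod zero = fromℕ m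
    predMod (suc j) = inject₁ j

    toℕ-sucMod : ∀ (i : Fin (suc m)) → toℕ (sucMod i) ≡ suc (toℕ i) % suc m
    toℕ-sucMod i = FinP.toℕ-fromℕ< _

    sucMod-inject₁ : ∀ (j : Fin m) → sucMod (inject₁ j) ≡ suc j
    sucMod-inject₁ j = FinP.toℕ-injective (trans (toℕ-sucMod (inject₁ j))
      (trans (cong (λ z → suc z % suc m) (FinP.toℕ-inject₁ j)) (m<n⇒m%n≡m (s≤s (FinP.toℕ<n j)))))

    sucMod-fromℕ : sucMod (fromℕ m) ≡ zero
    sucMod-fromℕ = FinP.toℕ-injective (trans (toℕ-sucMod (fromℕ m))
      (trans (cong (λ z → suc z % suc m) (FinP.toℕ-fromℕ m)) (n%n≡0 (suc m))))

    sucMod-predMod : ∀ a → sucMod (predMod a) ≡ a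
    sucMod-predMod zero = sucMod-fromℕ
    sucMod-predMod (suc j) = sucMod-inject₁ j

    predMod-sucMod : ∀ a → predMod (sucMod a) ≡ a
    predMod-sucMod a with fromℕ⊎inject₁ a
    ... | inj₁ refl = cong predMod sucMod-fromℕ
    ... | inj₂ (j , refl) = cong predMod (sucMod-inject₁ j)


    predMod-injective : ∀ {a b} → predMod a ≡ predMod b → a ≡ b
    predMod-injective {a} {b} e = trans (sym (sucMod-predMod a)) (trans (cong sucMod e) (sucMod-predMod b))

  NonAdjacent : ∀ {m} → Fin (suc m) → Fin (suc m) → Set
  NonAdjacent a b = a ≢ b × sucMod a ≢ b × sucMod b ≢ a

  NonAdjacent-sym : ∀ {m} {a b : Fin (suc m)} → NonAdjacent a b → NonAdjacent b a
  NonAdjacent-sym (a≢b , sa≢b , sb≢a) = (λ e → a≢b (sym e)) , sb≢a , sa≢b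

module Windows where

  open Cyclic

  lookup-ext : ∀ {a} {A : Set a} {n} {u v : Vec A n} → (∀ p → lookup u p ≡ lookup v p) → u ≡ v
  lookup-ext {u = u} {v} e = trans (sym (VecP.tabulate∘lookup u)) (trans (VecP.tabulate-cong e) (VecP.tabulate∘lookup v))

  suc≢inject₁ : ∀ {m} (j : Fin m) → ¬ (Fin.suc j ≡ inject₁ j)
  suc≢inject₁ j e = ℕP.1+n≢n (trans (cong toℕ e) (FinP.toℕ-inject₁ j))

  module _ {k : ℕ} where
    private m = suc k

    -- A window lists w(1), …, w(n) of a bijection w of ℤ with w(i + n) = w(i) + n; the affine
    -- letter 0 exchanges w(0) = w(n) − n and w(1), whence the shift by n.
    shift : Fin (suc m) → ℤ
    shift zero = + suc m
    shift (suc _) = + 0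

    predMod≢ : ∀ (a : Fin (suc m)) → ¬ predMod a ≡ a
    predMod≢ zero ()
    predMod≢ (suc j) e = suc≢inject₁ j (sym e)

    if-false : ∀ {A : Set} (b : Bool) (x y : A) → b ≡ false → (if b then x else y) ≡ y
    if-false false x y refl = refl

    if-true : ∀ {A : Set} (b : Bool) (x y : A) → b ≡ true → (if b then x else y) ≡ x
    if-true true x y refl = refl

    rmul₀-entry : Window m → Fin (suc m) → ℤ
    rmul₀-entry W p = if p == zero then lookup W (fromℕ m) - + suc m
             else if p == fromℕ m then lookup W zero + + suc m else lookup W p
    rmulₛ-entry : Window m → Fin m → Fin (suc m) → ℤ
    rmulₛ-entry W j p = if p == inject₁ j then lookup W (suc j)
               else if p == suc j then lookup W (inject₁ j) else lookup W p

    lookup-rmul-other : ∀ (W : Window m) a p → ¬ p ≡ a → ¬ p ≡ predMod a → lookup (rmul W a) p ≡ lookup W p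
    lookup-rmul-other W zero p n1 n2 =
      trans (VecP.lookup∘tabulate (rmul₀-entry W) p)
      (trans (if-false _ _ _ (==-≢ n1)) (if-false _ _ _ (==-≢ n2)))
    lookup-rmul-other W (suc j) p n1 n2 =
      trans (VecP.lookup∘tabulate (rmulₛ-entry W j) p)
      (trans (if-false _ _ _ (==-≢ n2)) (if-false _ _ _ (==-≢ n1)))

    lookup-rmul-self : ∀ (W : Window m) a → lookup (rmul W a) a ≡ lookup W (predMod a) - shift a
    lookup-rmul-self W zero = trans (VecP.lookup∘tabulate (rmul₀-entry W) zero) refl
    lookup-rmul-self W (suc j) =
      trans (VecP.lookup∘tabulate (rmulₛ-entry W j) (suc j))
      (trans (if-false _ _ _ (==-≢ (suc≢inject₁ j)))
      (trans (if-true _ _ _ (==-refl (suc j))) (sym (ℤP.+-identityʳ _))))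

    lookup-rmul-predMod : ∀ (W : Window m) a → lookup (rmul W a) (predMod a) ≡ lookup W a + shift a
    lookup-rmul-predMod W zero =
      trans (VecP.lookup∘tabulate (rmul₀-entry W) (fromℕ m))
      (trans (if-false (fromℕ m == zero) (lookup W (fromℕ m) - + suc m) _ (==-≢ {a = fromℕ m} {b = zero} λ ())) (if-true _ _ _ (==-refl (fromℕ m))))
    lookup-rmul-predMod W (suc j) =
      trans (VecP.lookup∘tabulate (rmulₛ-entry W j) (inject₁ j))
      (trans (if-true _ _ _ (==-refl (inject₁ j))) (sym (ℤP.+-identityʳ _)))

    module _ {a b : Fin (suc m)} (na : NonAdjacent a b) where
      b≢a : b ≢ a
      b≢a e = proj₁ na (sym e)
      b≢pa : b ≢ predMod a
      b≢pa e = proj₂ (proj₂ na) (trans (cong sucMod e) (sucMod-predMod a))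
      pb≢a : predMod b ≢ a
      pb≢a e = proj₁ (proj₂ na) (trans (cong sucMod (sym e)) (sucMod-predMod b))
      pb≢pa : predMod b ≢ predMod a
      pb≢pa e = proj₁ na (sym (predMod-injective e))

    rmul-comm : ∀ (W : Window m) a b → NonAdjacent a b → rmul (rmul W a) b ≡ rmul (rmul W b) a
    rmul-comm W a b na = lookup-ext pt
      where
      nb = NonAdjacent-sym na
      pt : ∀ p → lookup (rmul (rmul W a) b) p ≡ lookup (rmul (rmul W b) a) p
      pt p with p FinP.≟ b | p FinP.≟ predMod b | p FinP.≟ a | p FinP.≟ predMod a
      ... | yes refl | _ | _ | _ =
        trans (lookup-rmul-self (rmul W a) b)
        (trans (cong (_- shift b) (lookup-rmul-other W a (predMod b) (pb≢a na) (pb≢pa na)))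
        (trans (sym (lookup-rmul-self W b)) (sym (lookup-rmul-other (rmul W b) a b (b≢a na) (b≢pa na)))))
      ... | no _ | yes refl | _ | _ =
        trans (lookup-rmul-predMod (rmul W a) b)
        (trans (cong (_+ shift b) (lookup-rmul-other W a b (b≢a na) (b≢pa na)))
        (trans (sym (lookup-rmul-predMod W b)) (sym (lookup-rmul-other (rmul W b) a (predMod b) (pb≢a na) (pb≢pa na)))))
      ... | no x1 | no x2 | yes refl | _ =
        trans (lookup-rmul-other (rmul W a) b a x1 x2)
        (trans (lookup-rmul-self W a)
        (trans (cong (_- shift a) (sym (lookup-rmul-other W b (predMod a) (pb≢a nb) (pb≢pa nb))))
        (sym (lookup-rmul-self (rmul W b) a))))
      ... | no x1 | no x2 | no _ | yes refl =
        trans (lookup-rmul-other (rmul W a) b (predMod a) x1 x2)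
        (trans (lookup-rmul-predMod W a)
        (trans (cong (_+ shift a) (sym (lookup-rmul-other W b a (b≢a nb) (b≢pa nb))))
        (sym (lookup-rmul-predMod (rmul W b) a))))
      ... | no x1 | no x2 | no x3 | no x4 =
        trans (lookup-rmul-other (rmul W a) b p x1 x2)
        (trans (lookup-rmul-other W a p x3 x4)
        (trans (sym (lookup-rmul-other W b p x1 x2)) (sym (lookup-rmul-other (rmul W b) a p x3 x4))))

    ascent-rmul-nonAdjacent : ∀ (W : Window m) a b → NonAdjacent a b → ascent (rmul W a) b ≡ ascent W b
    ascent-rmul-nonAdjacent W a zero na =
      cong₂ (λ x y → ⌊ x - + suc m <? y ⌋)
        (lookup-rmul-other W a (fromℕ m) (pb≢a na) (pb≢pa na))
        (lookup-rmul-other W a zero (b≢a na) (b≢pa na))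
    ascent-rmul-nonAdjacent W a (suc j) na =
      cong₂ (λ x y → ⌊ x <? y ⌋)
        (lookup-rmul-other W a (inject₁ j) (pb≢a na) (pb≢pa na))
        (lookup-rmul-other W a (suc j) (b≢a na) (b≢pa na))

    evalFrom-swap : ∀ (W : Window m) a b v → NonAdjacent a b →
      evalFrom W (a ∷ b ∷ v) ≡ evalFrom W (b ∷ a ∷ v)
    evalFrom-swap W a b v na
      with ascent W a in ea | ascent W b in eb
    ... | true | true rewrite ascent-rmul-nonAdjacent W a b na | eb | ascent-rmul-nonAdjacent W b a (NonAdjacent-sym na) | ea
          = cong (λ z → evalFrom z v) (rmul-comm W a b na)
    ... | true | false rewrite ascent-rmul-nonAdjacent W a b na | eb = refl
    ... | false | true rewrite ascent-rmul-nonAdjacent W b a (NonAdjacent-sym na) | ea = refl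
    ... | false | false = refl


module CycDecWords where

  open Cyclic
  open Windows

  ∨-false : ∀ {a b} → (a ∨ b) ≡ false → a ≡ false × b ≡ false
  ∨-false {false} {false} refl = refl , refl

  ∨-falseˡ : ∀ {a b} → a ≡ false → (a ∨ b) ≡ b
  ∨-falseˡ refl = refl

  ∨-trueˡ : ∀ {a} b → a ≡ true → (a ∨ b) ≡ true
  ∨-trueˡ b refl = refl

  ∨-trueʳ : ∀ a {b} → b ≡ true → (a ∨ b) ≡ true
  ∨-trueʳ false refl = refl
  ∨-trueʳ true refl = refl

  cycDec-∷⁻ : ∀ {m} (a : Fin (suc m)) u → cycDec (a ∷ u) ≡ true →
    elemOf a u ≡ false × elemOf (sucMod a) u ≡ false × cycDec u ≡ true
  cycDec-∷⁻ a u c with elemOf a u | elemOf (sucMod a) u | cycDec u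
  cycDec-∷⁻ a u refl | false | false | true = refl , refl , refl

  true≢false : true ≢ false
  true≢false ()

  ⌊⌋-true : ∀ {p} {P : Set p} (d : Dec P) → P → ⌊ d ⌋ ≡ true
  ⌊⌋-true (yes _) _ = refl
  ⌊⌋-true (no ¬p) p = ⊥-elim (¬p p)

  module _ {m : ℕ} where
    elemOf-++ : ∀ (a : Fin (suc m)) u v → elemOf a (u ++ v) ≡ (elemOf a u ∨ elemOf a v)
    elemOf-++ a [] v = refl
    elemOf-++ a (x ∷ u) v = trans (cong (_∨_ (x == a)) (elemOf-++ a u v)) (sym (BP.∨-assoc (x == a) _ _))

    elemOf-head : ∀ (a : Fin (suc m)) u → elemOf a (a ∷ u) ≡ true
    elemOf-head a u rewrite ==-refl a = refl

    cycDec-prefix⁻ : ∀ (pre x : Word m) → cycDec (pre ++ x) ≡ true → ∀ y → elemOf y pre ≡ true →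
      elemOf y x ≡ false × elemOf (sucMod y) x ≡ false
    cycDec-prefix⁻ [] x c y ()
    cycDec-prefix⁻ (a ∷ pre) x c y e with cycDec-∷⁻ a (pre ++ x) c
    ... | e1 , e2 , c' = case (a FinP.≟ y) e
      where
      case : (d : Dec (a ≡ y)) → (does d ∨ elemOf y pre) ≡ true → elemOf y x ≡ false × elemOf (sucMod y) x ≡ false
      case (yes refl) _ = proj₂ (∨-false (trans (sym (elemOf-++ a pre x)) e1)) ,
                        proj₂ (∨-false (trans (sym (elemOf-++ (sucMod a) pre x)) e2))
      case (no _) e' = cycDec-prefix⁻ pre x c' y e'

  module _ {k : ℕ} where
    private m = suc k

    -- Along a cyclically decreasing word, reading the letter b only moves the entry at position b
    -- from b + 1 down to b; this invariant shows every step is an ascent and that the window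
    -- determines the set of letters.
    WindowOf : Window m → Word m → Set
    WindowOf W pre = ∀ p → (elemOf p pre ≡ true → lookup W p ≡ + toℕ p)
                    × (elemOf p pre ≡ false → + suc (toℕ p) ℤ.≤ lookup W p)
                    × (elemOf p pre ≡ false → elemOf (sucMod p) pre ≡ false → lookup W p ≡ + suc (toℕ p))

    WindowOf-[] : WindowOf idWindow []
    WindowOf-[] p = (λ ()) , (λ _ → ℤP.≤-reflexive (sym (VecP.lookup∘tabulate (λ q → + suc (toℕ q)) p))) , (λ _ _ → VecP.lookup∘tabulate (λ q → + suc (toℕ q)) p)

    private
      windowOf-predMod : ∀ W pre b → WindowOf W pre → elemOf b pre ≡ false → elemOf (predMod b) pre ≡ false →
        lookup W (predMod b) ≡ + suc (toℕ (predMod b))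
      windowOf-predMod W pre b I e1 e2 = proj₂ (proj₂ (I (predMod b))) e2 (trans (cong (λ z → elemOf z pre) (sucMod-predMod b)) e1)

    WindowOf-ascent : ∀ W pre b → WindowOf W pre → elemOf b pre ≡ false → elemOf (predMod b) pre ≡ false → ascent W b ≡ true
    WindowOf-ascent W pre zero I e1 e2 = ⌊⌋-true (_ <? _) lt
      where
      wp = windowOf-predMod W pre zero I e1 e2
      lt : lookup W (fromℕ m) - + suc m ℤ.< lookup W zero
      eq : lookup W (fromℕ m) - + suc m ≡ + 0
      eq = trans (cong (_- + suc m) (trans wp (cong (λ z → + suc z) (FinP.toℕ-fromℕ m)))) (ℤP.+-inverseʳ (+ suc m))
      lt = subst (ℤ._< lookup W zero) (sym eq) (ℤP.<-≤-trans (+<+ (s≤s z≤n)) (proj₁ (proj₂ (I zero)) e1))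
    WindowOf-ascent W pre (suc j) I e1 e2 = ⌊⌋-true (_ <? _) lt
      where
      wp = windowOf-predMod W pre (suc j) I e1 e2
      lt : lookup W (inject₁ j) ℤ.< lookup W (suc j)
      lt = subst (ℤ._< lookup W (suc j)) (sym (trans wp (cong (λ z → + suc z) (FinP.toℕ-inject₁ j)))) (ℤP.<-≤-trans (+<+ (ℕP.n<1+n _)) (proj₁ (proj₂ (I (suc j))) e1))

    WindowOf-snoc : ∀ W pre b → WindowOf W pre → elemOf b pre ≡ false → elemOf (predMod b) pre ≡ false → WindowOf (rmul W b) (pre ++ b ∷ [])
    WindowOf-snoc W pre b I e1 e2 p with p FinP.≟ b | p FinP.≟ predMod b
    ... | yes refl | _ = c1 , (λ e → ⊥-elim (true≢false (trans (sym memb) e))) , (λ e → ⊥-elim (true≢false (trans (sym memb) e)))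
      where
      memb : elemOf p (pre ++ p ∷ []) ≡ true
      memb = trans (elemOf-++ p pre (p ∷ [])) (∨-trueʳ (elemOf p pre) (elemOf-head p []))
      c1 : elemOf p (pre ++ p ∷ []) ≡ true → lookup (rmul W p) p ≡ + toℕ p
      c1 _ = trans (lookup-rmul-self W p) (trans (cong (_- shift p) (windowOf-predMod W pre p I e1 e2)) (val p))
        where
        val : ∀ (b : Fin (suc m)) → + suc (toℕ (predMod b)) - shift b ≡ + toℕ b
        val zero = trans (cong (λ z → + suc z - + suc m) (FinP.toℕ-fromℕ m)) (ℤP.+-inverseʳ (+ suc m))
        val (suc j) = trans (cong (λ z → + suc z - + 0) (FinP.toℕ-inject₁ j)) (ℤP.+-identityʳ _)
    ... | no pb | yes refl = (λ e → ⊥-elim (true≢false (trans (sym e) notm))) , c2 , c3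
      where
      notm : elemOf (predMod b) (pre ++ b ∷ []) ≡ false
      notm = trans (elemOf-++ (predMod b) pre (b ∷ [])) (trans (∨-falseˡ e2) (trans (∨-falseˡ (==-≢ λ e → pb (sym e))) refl))
      c2 : _ → + suc (toℕ (predMod b)) ℤ.≤ lookup (rmul W b) (predMod b)
      c2 _ rewrite lookup-rmul-predMod W b = val b (proj₁ (proj₂ (I b)) e1)
        where
        val : ∀ b → + suc (toℕ b) ℤ.≤ lookup W b → + suc (toℕ (predMod b)) ℤ.≤ lookup W b + shift b
        val zero le rewrite FinP.toℕ-fromℕ m =
          ℤP.≤-trans (+≤+ (ℕP.m≤n+m (suc m) 1)) (ℤP.+-monoˡ-≤ (+ suc m) le)
        val (suc j) le rewrite FinP.toℕ-inject₁ j | ℤP.+-identityʳ (lookup W (suc j)) =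
          ℤP.≤-trans (+≤+ (ℕP.n≤1+n _)) le
      c3 : _ → elemOf (sucMod (predMod b)) (pre ++ b ∷ []) ≡ false → _
      c3 _ e rewrite sucMod-predMod b = ⊥-elim (true≢false (trans (sym (trans (elemOf-++ b pre (b ∷ [])) (∨-trueʳ (elemOf b pre) (elemOf-head b [])))) e))
    ... | no pb | no ppb = c1 , c2 , c3
      where
      same : lookup (rmul W b) p ≡ lookup W p
      same = lookup-rmul-other W b p pb ppb
      mem : elemOf p (pre ++ b ∷ []) ≡ elemOf p pre
      mem = trans (elemOf-++ p pre (b ∷ [])) (trans (cong (elemOf p pre ∨_) (∨-falseˡ (==-≢ λ e → pb (sym e)))) (BP.∨-identityʳ _))
      c1 : _
      c1 e rewrite same = proj₁ (I p) (trans (sym mem) e)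
      c2 : _
      c2 e rewrite same = proj₁ (proj₂ (I p)) (trans (sym mem) e)
      c3 : _
      c3 e e' rewrite same = proj₂ (proj₂ (I p)) (trans (sym mem) e)
        (proj₁ (∨-false (trans (sym (elemOf-++ (sucMod p) pre (b ∷ []))) e')))

    cycDec-∉-prefix : ∀ pre b (u : Word m) → cycDec (pre ++ b ∷ u) ≡ true → elemOf b pre ≡ false
    cycDec-∉-prefix pre b u c = BP.¬-not (λ e → true≢false (trans (sym (elemOf-head b u)) (proj₁ (cycDec-prefix⁻ pre (b ∷ u) c b e))))
    cycDec-predMod-∉-prefix : ∀ pre b (u : Word m) → cycDec (pre ++ b ∷ u) ≡ true → elemOf (predMod b) pre ≡ false
    cycDec-predMod-∉-prefix pre b u c = BP.¬-not (λ e → true≢false (trans (sym (elemOf-head b u))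
             (trans (cong (λ z → elemOf z (b ∷ u)) (sym (sucMod-predMod b))) (proj₂ (cycDec-prefix⁻ pre (b ∷ u) c (predMod b) e)))))

    evalFrom-cycDec : ∀ (pre u : Word m) W → WindowOf W pre → cycDec (pre ++ u) ≡ true →
      Σ (Window m) (λ W' → evalFrom W u ≡ just W' × WindowOf W' (pre ++ u))
    evalFrom-cycDec pre [] W I c = W , refl , subst (WindowOf W) (sym (LP.++-identityʳ pre)) I
    evalFrom-cycDec pre (b ∷ u) W I c with evalFrom-cycDec (pre ++ b ∷ []) u (rmul W b) (WindowOf-snoc W pre b I (cycDec-∉-prefix pre b u c) (cycDec-predMod-∉-prefix pre b u c))
                                     (subst (λ z → cycDec z ≡ true) (sym (LP.++-assoc pre (b ∷ []) u)) c)
    ... | W' , ev , I' = W' , trans (cong (λ z → if z then evalFrom (rmul W b) u else nothing)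
                                      (WindowOf-ascent W pre b I (cycDec-∉-prefix pre b u c) (cycDec-predMod-∉-prefix pre b u c))) ev ,
                           subst (WindowOf W') (LP.++-assoc pre (b ∷ []) u) I'

    evalWord-cycDec : ∀ (u : Word m) → cycDec u ≡ true → Σ (Window m) (λ W → evalWord u ≡ just W × WindowOf W u)
    evalWord-cycDec u c = evalFrom-cycDec [] u idWindow WindowOf-[] c

    private
      ≡+n-≥1+n-absurd : ∀ {x : ℤ} {n : ℕ} → x ≡ + n → + suc n ℤ.≤ x → ⊥
      ≡+n-≥1+n-absurd refl (+≤+ le) = ℕP.1+n≰n le

    evalWord-cycDec-letters : ∀ (u v : Word m) → cycDec u ≡ true → cycDec v ≡ true → evalWord u ≡ evalWord v →
      ∀ p → elemOf p u ≡ elemOf p v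
    evalWord-cycDec-letters u v cu cv e p with evalWord-cycDec u cu | evalWord-cycDec v cv
    ... | W , eu , Iu | W2 , ev , Iv with trans (sym eu) (trans e ev)
    ... | refl with elemOf p u in epu | elemOf p v in epv
    ... | true | true = refl
    ... | false | false = refl
    ... | true | false = ⊥-elim (≡+n-≥1+n-absurd (proj₁ (Iu p) epu) (proj₁ (proj₂ (Iv p)) epv))
    ... | false | true = ⊥-elim (≡+n-≥1+n-absurd (proj₁ (Iv p) epv) (proj₁ (proj₂ (Iu p)) epu))


module CartanSums where

  open Sums
  open +-*-Solver using (solve; _:+_; _:*_; _:=_; con; :-_; _:-_)

  δ : ℕ → ℕ → ℤ
  δ zero zero = + 1
  δ zero (suc _) = + 0
  δ (suc _) zero = + 0
  δ (suc a) (suc b) = δ a b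

  δ-≡ : ∀ {a b} → a ≡ b → δ a b ≡ + 1
  δ-≡ {zero} refl = refl
  δ-≡ {suc a} refl = δ-≡ {a} refl

  δ-≢ : ∀ {a b} → ¬ a ≡ b → δ a b ≡ + 0
  δ-≢ {zero} {zero} ne = ⊥-elim (ne refl)
  δ-≢ {zero} {suc b} ne = refl
  δ-≢ {suc a} {zero} ne = refl
  δ-≢ {suc a} {suc b} ne = δ-≢ (λ e → ne (cong suc e))

  ∑Fin-δ-0-suc : ∀ n {g : Fin n → ℕ} → ∑Fin {n} (λ j → δ 0 (suc (g j))) ≡ + 0
  ∑Fin-δ-0-suc zero = refl
  ∑Fin-δ-0-suc (suc n) {g} = trans (ℤP.+-identityˡ _) (∑Fin-δ-0-suc n {g ∘ suc})

  ∑Fin-δ-< : ∀ n c → c ℕ.< n → ∑Fin {n} (λ j → δ c (toℕ j)) ≡ + 1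
  ∑Fin-δ-< (suc n) zero lt = cong (_+_ (+ 1)) (∑Fin-δ-0-suc n {λ j → toℕ (suc j)})
  ∑Fin-δ-< (suc n) (suc c) (s≤s lt) = trans (ℤP.+-identityˡ _) (∑Fin-δ-< n c lt)

  ∑Fin-δ-≥ : ∀ n c → n ℕ.≤ c → ∑Fin {n} (λ j → δ c (toℕ j)) ≡ + 0
  ∑Fin-δ-≥ zero c le = refl
  ∑Fin-δ-≥ (suc n) (suc c) (s≤s le) = trans (ℤP.+-identityˡ _) (∑Fin-δ-≥ n c le)

  δ-sym : ∀ a b → δ a b ≡ δ b a
  δ-sym zero zero = refl
  δ-sym zero (suc b) = refl
  δ-sym (suc a) zero = refl
  δ-sym (suc a) (suc b) = δ-sym a b


  n≢2+n : ∀ {x : ℕ} → x ≢ suc (suc x)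
  n≢2+n {zero} ()
  n≢2+n {suc x} e = n≢2+n (ℕP.suc-injective e)

  cartan-δ : ∀ {m} (k j : Fin m) → cartan k j ≡ + 2 * δ (toℕ k) (toℕ j) - δ (toℕ k) (suc (toℕ j)) - δ (suc (toℕ k)) (toℕ j)
  cartan-δ k j with toℕ k ℕ.≟ toℕ j | toℕ k ℕ.≟ suc (toℕ j) | suc (toℕ k) ℕ.≟ toℕ j
  ... | yes p | yes q | _ = ⊥-elim (ℕP.1+n≢n (trans (sym q) p))
  ... | yes p | no _ | yes r = ⊥-elim (ℕP.1+n≢n (trans r (sym p)))
  ... | yes p | no q | no r rewrite δ-≡ p | δ-≢ q | δ-≢ r = refl
  ... | no _ | yes q | yes r = ⊥-elim (n≢2+n (trans q (cong suc (sym r))))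
  ... | no p | yes q | no r rewrite δ-≢ p | δ-≡ q | δ-≢ r = refl
  ... | no p | no q | yes r rewrite δ-≢ p | δ-≢ q | δ-≡ r = refl
  ... | no p | no q | no r rewrite δ-≢ p | δ-≢ q | δ-≢ r = refl

  ∑Fin-2a-b-c : ∀ {n} (A B C : Fin n → ℤ) → ∑Fin (λ j → + 2 * A j - B j - C j) ≡ + 2 * ∑Fin A - ∑Fin B - ∑Fin C
  ∑Fin-2a-b-c A B C = trans (∑Fin-+ (λ j → + 2 * A j - B j) (λ j → - C j))
    (cong₂ _+_ (trans (∑Fin-+ (λ j → + 2 * A j) (λ j → - B j)) (cong₂ _+_ (∑Fin-* (+ 2) A) (∑Fin-neg B))) (∑Fin-neg C))

  ∑Fin-cartan-row : ∀ {m} (r : Fin m) → ∑Fin (cartan r) ≡ + 2 * ∑Fin {m} (λ j → δ (toℕ r) (toℕ j)) - ∑Fin {m} (λ j → δ (toℕ r) (suc (toℕ j))) - ∑Fin {m} (λ j → δ (suc (toℕ r)) (toℕ j))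
  ∑Fin-cartan-row {m} r = trans (∑Fin-cong (λ j → cartan-δ r j)) (∑Fin-2a-b-c {m} (λ j → δ (toℕ r) (toℕ j)) (λ j → δ (toℕ r) (suc (toℕ j))) (λ j → δ (suc (toℕ r)) (toℕ j)))

  ∑Fin-cartan-col : ∀ {m} (j : Fin m) → ∑Fin (λ k → cartan k j) ≡ + 2 * ∑Fin {m} (λ k → δ (toℕ j) (toℕ k)) - ∑Fin {m} (λ k → δ (suc (toℕ j)) (toℕ k)) - ∑Fin {m} (λ k → δ (toℕ j) (suc (toℕ k)))
  ∑Fin-cartan-col {m} j = trans (∑Fin-cong (λ k → trans (cartan-δ k j)
    (cong₂ _-_ (cong₂ _-_ (cong (+ 2 *_) (δ-sym (toℕ k) (toℕ j))) (δ-sym (toℕ k) (suc (toℕ j)))) (δ-sym (suc (toℕ k)) (toℕ j)))))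
    (∑Fin-2a-b-c {m} (λ k → δ (toℕ j) (toℕ k)) (λ k → δ (suc (toℕ j)) (toℕ k)) (λ k → δ (toℕ j) (suc (toℕ k))))

  ∑Fin-δ-interior : ∀ m c → 0 ℕ.< c → suc c ℕ.< m →
    + 2 * ∑Fin {m} (λ j → δ c (toℕ j)) - ∑Fin {m} (λ j → δ c (suc (toℕ j))) - ∑Fin {m} (λ j → δ (suc c) (toℕ j)) ≡ + 0
  ∑Fin-δ-interior m (suc c) p q = trans (cong₂ (λ x y → + 2 * ∑Fin {m} (λ j → δ (suc c) (toℕ j)) - x - y) (∑Fin-δ-< m c (ℕP.<-trans (ℕP.n<1+n c) (ℕP.<-trans (ℕP.n<1+n _) q))) (∑Fin-δ-< m (suc (suc c)) q))
                         (cong (λ x → + 2 * x - + 1 - + 1) (∑Fin-δ-< m (suc c) (ℕP.<-trans (ℕP.n<1+n _) q)))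

  ∑Fin-cartan-row-interior : ∀ {m} (r : Fin m) → 0 ℕ.< toℕ r → suc (toℕ r) ℕ.< m → ∑Fin (cartan r) ≡ + 0
  ∑Fin-cartan-row-interior {m} r p q = trans (∑Fin-cartan-row r) (∑Fin-δ-interior m (toℕ r) p q)

  ∑Fin-cartan-col-interior : ∀ {m} (j : Fin m) → 0 ℕ.< toℕ j → suc (toℕ j) ℕ.< m → ∑Fin (λ k → cartan k j) ≡ + 0
  ∑Fin-cartan-col-interior {m} j p q = trans (∑Fin-cartan-col j) (
    (trans (swap-subtrahends (∑Fin {m} (λ k → δ (toℕ j) (toℕ k))) (∑Fin {m} (λ k → δ (suc (toℕ j)) (toℕ k))) (∑Fin {m} (λ k → δ (toℕ j) (suc (toℕ k))))) (∑Fin-δ-interior m (toℕ j) p q)))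
    where
    swap-subtrahends : ∀ a b c → + 2 * a - b - c ≡ + 2 * a - c - b
    swap-subtrahends = solve 3 (λ a b c → con (+ 2) :* a :- b :- c := con (+ 2) :* a :- c :- b) refl

  ∑Fin-δ-first : ∀ m → 1 ℕ.< m → + 2 * ∑Fin {m} (λ j → δ 0 (toℕ j)) - ∑Fin {m} (λ j → δ 0 (suc (toℕ j))) - ∑Fin {m} (λ j → δ 1 (toℕ j)) ≡ + 1
  ∑Fin-δ-first m q = trans (cong₂ (λ x y → + 2 * x - ∑Fin {m} (λ j → δ 0 (suc (toℕ j))) - y) (∑Fin-δ-< m 0 (ℕP.<-trans (s≤s z≤n) q)) (∑Fin-δ-< m 1 q))
                     (cong (λ x → + 2 * + 1 - x - + 1) (∑Fin-δ-0-suc m {toℕ}))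

  ∑Fin-cartan-row-first : ∀ {m} (r : Fin m) → toℕ r ≡ 0 → 1 ℕ.< m → ∑Fin (cartan r) ≡ + 1
  ∑Fin-cartan-row-first {m} r p q = trans (∑Fin-cartan-row r) (trans (cong (λ c → + 2 * ∑Fin {m} (λ j → δ c (toℕ j)) - ∑Fin {m} (λ j → δ c (suc (toℕ j))) - ∑Fin {m} (λ j → δ (suc c) (toℕ j))) p) (∑Fin-δ-first m q))

  ∑Fin-δ-last : ∀ m c → suc c ≡ m → 0 ℕ.< c →
    + 2 * ∑Fin {m} (λ k → δ c (toℕ k)) - ∑Fin {m} (λ k → δ (suc c) (toℕ k)) - ∑Fin {m} (λ k → δ c (suc (toℕ k))) ≡ + 1
  ∑Fin-δ-last m (suc c) p q = trans (cong₂ (λ x y → + 2 * ∑Fin {m} (λ k → δ (suc c) (toℕ k)) - x - y) (∑Fin-δ-≥ m (suc (suc c)) (ℕP.≤-reflexive (sym p))) (∑Fin-δ-< m c lt0))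
                         (cong (λ x → + 2 * x - + 0 - + 1) (∑Fin-δ-< m (suc c) lt1))
    where
    lt1 : suc c ℕ.< m
    lt1 = subst (suc c ℕ.<_) p (ℕP.n<1+n _)
    lt0 : c ℕ.< m
    lt0 = ℕP.<-trans (ℕP.n<1+n c) lt1

  ∑Fin-cartan-col-last : ∀ {m} (j : Fin m) → suc (toℕ j) ≡ m → 0 ℕ.< toℕ j → ∑Fin (λ k → cartan k j) ≡ + 1
  ∑Fin-cartan-col-last {m} j p q = trans (∑Fin-cartan-col j) (∑Fin-δ-last m (toℕ j) p q)


module Roots where

  open Sums
  open Cyclic
  open CartanSums
  open +-*-Solver using (solve; _:+_; _:*_; _:=_; con; :-_; _:-_)

  module _ {m : ℕ} where
    pair-refl-r : ∀ (j : Fin (suc m)) μ a → pair (refl-r j μ) a ≡ pair μ a - pair μ j * pair (α j) a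
    pair-refl-r j μ (suc a) = refl
    pair-refl-r j μ zero =
      trans (cong -_ (trans (∑-allFin (refl-r j μ))
            (trans (∑Fin-+ μ (λ k → - (pair μ j * α j k)))
            (cong₂ _+_ (sym (∑-allFin μ)) (trans (∑Fin-neg (λ k → pair μ j * α j k)) (cong -_ (trans (∑Fin-* (pair μ j) (α j)) (cong (pair μ j *_) (sym (∑-allFin (α j)))))))))))
      (negate-difference (∑ μ (allFin m)) (pair μ j) (∑ (α j) (allFin m)))
      where
      negate-difference : ∀ a b c → - (a + - (b * c)) ≡ - a - b * (- c)
      negate-difference = solve 3 (λ a b c → :- (a :+ :- (b :* c)) := :- a :- b :* (:- c)) refl

    ∑Fin-pair : ∀ (μ : Weight m) → ∑Fin {suc m} (pair μ) ≡ + 0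
    ∑Fin-pair μ = trans (cong (λ z → - z + ∑Fin μ) (∑-allFin μ)) (ℤP.+-inverseˡ (∑Fin μ))

    refl-r-comm : ∀ (a b : Fin (suc m)) μ → pair (α b) a ≡ + 0 → pair (α a) b ≡ + 0 →
      ∀ k → refl-r a (refl-r b μ) k ≡ refl-r b (refl-r a μ) k
    refl-r-comm a b μ e1 e2 k =
      trans (cong (λ z → refl-r b μ k - z * α a k) (trans (pair-refl-r b μ a) (cong (λ z → pair μ a - pair μ b * z) e1)))
      (trans (reflections-commute (μ k) (pair μ b) (α b k) (pair μ a) (α a k))
      (sym (cong (λ z → refl-r a μ k - z * α b k) (trans (pair-refl-r a μ b) (cong (λ z → pair μ b - pair μ a * z) e2)))))
      where
      reflections-commute : ∀ x pb ab pa aa → x - pb * ab - (pa - pb * + 0) * aa ≡ x - pa * aa - (pb - pa * + 0) * ab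
      reflections-commute = solve 5 (λ x pb ab pa aa → x :- pb :* ab :- (pa :- pb :* con (+ 0)) :* aa := x :- pa :* aa :- (pb :- pa :* con (+ 0)) :* ab) refl

    pair-refl-r-orthogonal : ∀ (a b : Fin (suc m)) μ → pair (α b) a ≡ + 0 → pair (refl-r b μ) a ≡ pair μ a
    pair-refl-r-orthogonal a b μ e = trans (pair-refl-r b μ a) (trans (cong (λ z → pair μ a - pair μ b * z) e)
      (trans (cong (_-_ (pair μ a)) (ℤP.*-zeroʳ (pair μ b))) (ℤP.+-identityʳ _)))

  module _ {k : ℕ} where
    private m = suc k

    toℕ-sucMod-< : ∀ (x : Fin (suc m)) → suc (toℕ x) ℕ.< suc m → toℕ (sucMod x) ≡ suc (toℕ x)
    toℕ-sucMod-< x lt = trans (toℕ-sucMod x) (m<n⇒m%n≡m lt)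

    sucMod-last : ∀ (x : Fin (suc m)) → suc (toℕ x) ≡ suc m → sucMod x ≡ zero
    sucMod-last x e = FinP.toℕ-injective (trans (toℕ-sucMod x) (trans (cong (_% suc m) e) (n%n≡0 (suc m))))

    sucMod-zero : sucMod {m} zero ≡ suc zero
    sucMod-zero = FinP.toℕ-injective (toℕ-sucMod-< zero (s≤s (s≤s z≤n)))

    cartan-far : ∀ (a j : Fin m) → ¬ toℕ a ≡ toℕ j → ¬ toℕ a ≡ suc (toℕ j) → ¬ suc (toℕ a) ≡ toℕ j → cartan a j ≡ + 0
    cartan-far a j p q r = trans (cartan-δ a j) (cong₃ (λ x y z → + 2 * x - y - z) (δ-≢ p) (δ-≢ q) (δ-≢ r))
      where
      cong₃ : ∀ {A : Set} (f : ℤ → ℤ → ℤ → A) {x x' y y' z z'} → x ≡ x' → y ≡ y' → z ≡ z' → f x y z ≡ f x' y' z'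
      cong₃ f refl refl refl = refl

    -- α₀ = −θ and α₀^∨ = −θ^∨, so pairings involving the affine node are minus row or column sums
    -- of the Cartan matrix.
    pair-α-nonAdjacent : ∀ (b a : Fin (suc m)) → NonAdjacent b a → pair (α b) a ≡ + 0
    pair-α-nonAdjacent zero zero (n1 , _) = ⊥-elim (n1 refl)
    pair-α-nonAdjacent (suc j) (suc a) (n1 , n2 , n3) = cartan-far a j p q r
      where
      p : ¬ toℕ a ≡ toℕ j
      p e = n1 (cong suc (sym (FinP.toℕ-injective e)))
      q : ¬ toℕ a ≡ suc (toℕ j)
      q e = n2 (FinP.toℕ-injective (trans (toℕ-sucMod-< (suc j) (subst (ℕ._< suc m) (cong suc e) (FinP.toℕ<n (suc a)))) (cong suc (sym e))))
      r : ¬ suc (toℕ a) ≡ toℕ j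
      r e = n3 (FinP.toℕ-injective (trans (toℕ-sucMod-< (suc a) (subst (ℕ._< suc m) (cong suc (sym e)) (FinP.toℕ<n (suc j)))) (cong suc e)))
    pair-α-nonAdjacent zero (suc a) (n1 , n2 , n3) =
      trans (cong -_ (trans (∑-allFin (cartan a)) (∑Fin-cartan-row-interior a p q))) refl
      where
      p : 0 ℕ.< toℕ a
      p with toℕ a in e
      ... | zero = ⊥-elim (n2 (trans sucMod-zero (cong suc (sym (FinP.toℕ-injective {i = a} {j = zero} e)))))
      ... | suc _ = s≤s z≤n
      q : suc (toℕ a) ℕ.< m
      q with ℕP.m≤n⇒m<n∨m≡n (FinP.toℕ<n a)
      ... | inj₁ lt = lt
      ... | inj₂ e = ⊥-elim (n3 (sucMod-last (suc a) (cong suc e)))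
    pair-α-nonAdjacent (suc j) zero (n1 , n2 , n3) =
      trans (cong -_ (trans (∑-allFin (λ k → cartan k j)) (∑Fin-cartan-col-interior j p q))) refl
      where
      p : 0 ℕ.< toℕ j
      p with toℕ j in e
      ... | zero = ⊥-elim (n3 (trans sucMod-zero (cong suc (sym (FinP.toℕ-injective {i = j} {j = zero} e)))))
      ... | suc _ = s≤s z≤n
      q : suc (toℕ j) ℕ.< m
      q with ℕP.m≤n⇒m<n∨m≡n (FinP.toℕ<n j)
      ... | inj₁ lt = lt
      ... | inj₂ e = ⊥-elim (n2 (sucMod-last (suc j) (cong suc e)))

    nontrivial-at-0 : ¬ predMod {m} zero ≡ sucMod zero → 1 ℕ.≤ k
    nontrivial-at-0 ne with k ℕ.≟ 0
    ... | yes e = ⊥-elim (ne (sym (trans sucMod-zero (FinP.toℕ-injective (sym (trans (FinP.toℕ-fromℕ m) (cong suc e)))))))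
    ... | no ne' = ℕP.n≢0⇒n>0 ne'

    nontrivial-at-1 : ¬ predMod {m} (suc zero) ≡ sucMod (suc zero) → 1 ℕ.≤ k
    nontrivial-at-1 ne with k ℕ.≟ 0
    ... | yes e = ⊥-elim (ne (sym (sucMod-last (suc zero) (cong (λ z → suc (suc z)) (sym e)))))
    ... | no ne' = ℕP.n≢0⇒n>0 ne'

    pair-α-predMod : ∀ (a : Fin (suc m)) → ¬ predMod a ≡ sucMod a → pair (α (predMod a)) a ≡ - + 1
    pair-α-predMod zero ne = cong -_ (trans (∑-allFin (λ i → cartan i (fromℕ k)))
                      (∑Fin-cartan-col-last (fromℕ k) (cong suc (FinP.toℕ-fromℕ k)) (subst (0 ℕ.<_) (sym (FinP.toℕ-fromℕ k)) (nontrivial-at-0 ne))))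
    pair-α-predMod (suc zero) ne = cong -_ (trans (∑-allFin (cartan {m} zero)) (∑Fin-cartan-row-first {m} zero refl (s≤s (nontrivial-at-1 ne))))
    pair-α-predMod (suc (suc a)) ne =
      trans (cartan-δ (suc a) (inject₁ a))
      (trans (cong (λ t → + 2 * δ (suc (toℕ a)) t - δ (suc (toℕ a)) (suc t) - δ (suc (suc (toℕ a))) t) (FinP.toℕ-inject₁ a))
      (trans (cong (λ z → + 2 * z - δ (suc (toℕ a)) (suc (toℕ a)) - δ (suc (suc (toℕ a))) (toℕ a)) (δ-≢ (ℕP.1+n≢n {toℕ a})))
      (trans (cong (λ z → + 2 * + 0 - z - δ (suc (suc (toℕ a))) (toℕ a)) (δ-≡ {suc (toℕ a)} refl))
      (cong (λ z → + 2 * + 0 - + 1 - z) (δ-≢ {suc (suc (toℕ a))} {toℕ a} (λ e → n≢2+n (sym e)))))))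


module NonAdjacentSwap where

  open Sums
  open Expansion
  open Cyclic
  open Roots

  module _ {k : ℕ} where
    private m = suc k

    -- Weights are functions, so lists of weights are compared pointwise rather than by _≡_.
    _≋_ : List (Weight m) → List (Weight m) → Set
    _≋_ = Pointwise _≗_

    ≋-refl : ∀ ms → ms ≋ ms
    ≋-refl ms = Pointwise.refl (λ _ → refl)

    Respects≋ : ∀ {A : Set} → (List (Weight m) → A → ℤ) → Set
    Respects≋ F = ∀ {ms ms'} → ms ≋ ms' → ∀ v → F ms v ≡ F ms' v

    pair-cong : ∀ {μ μ' : Weight m} → μ ≗ μ' → ∀ i → pair μ i ≡ pair μ' i
    pair-cong e zero = cong -_ (∑-cong (allFin m) e)
    pair-cong e (suc j) = e j

    refl-r-cong : ∀ {μ μ' : Weight m} → μ ≗ μ' → ∀ i → refl-r i μ ≗ refl-r i μ'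
    refl-r-cong e i k = cong₂ (λ x y → x - y * α i k) (e k) (pair-cong e i)

    PushGen-respects≋ : ∀ i K → Respects≋ K → ∀ {ms ms'} → ms ≋ ms' → PushGen i ms K ≡ PushGen i ms' K
    PushGen-respects≋ i K r [] = refl
    PushGen-respects≋ i K r {μ ∷ ms} {μ' ∷ ms'} (e ∷ es) =
      cong₂ _+_ (cong₂ _*_ (pair-cong e i) (r es false))
        (trans (PushGen-respects≋ i _ (λ es' b → r ((λ _ → refl) ∷ es') b) es)
               (PushGen-cong i ms' (λ a b → r (refl-r-cong e i ∷ ≋-refl a) b)))

    PushGen-swap : ∀ (a b : Fin (suc m)) → pair (α b) a ≡ + 0 → pair (α a) b ≡ + 0 →
      ∀ (H : List (Weight m) → Bool → Bool → ℤ) → (∀ {ms ms'} → ms ≋ ms' → ∀ x y → H ms x y ≡ H ms' x y) →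
      ∀ ms → PushGen b ms (λ ms₁ y → PushGen a ms₁ (λ ms₂ x → H ms₂ x y)) ≡ PushGen a ms (λ ms₁ x → PushGen b ms₁ (λ ms₂ y → H ms₂ x y))
    PushGen-swap a b ba≡0 ab≡0 H r [] = refl
    PushGen-swap a b ba≡0 ab≡0 H r (μ ∷ ms) =
      trans (cong (_+_ (pair μ b * PushGen a ms (λ ms₂ x → H ms₂ x false)))
              (trans (PushGen-+ b ms _ _)
              (cong₂ _+_ (trans (PushGen-* b ms (pair (refl-r b μ) a) (λ ms₁ y → H ms₁ false y))
                                (cong (_* PushGen b ms (λ ms₁ y → H ms₁ false y)) (pair-refl-r-orthogonal a b μ ba≡0)))
                         (trans (PushGen-swap a b ba≡0 ab≡0 (λ ms₂ x y → H (refl-r a (refl-r b μ) ∷ ms₂) x y) (λ es x y → r ((λ _ → refl) ∷ es) x y) ms)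
                                (PushGen-cong a ms (λ ms₁ x → PushGen-cong b ms₁ (λ ms₂ y → r (refl-r-comm a b μ ba≡0 ab≡0 ∷ ≋-refl ms₂) x y)))))))
      (trans (+-left-comm (pair μ b * PushGen a ms (λ ms₂ x → H ms₂ x false)) (pair μ a * PushGen b ms (λ ms₁ y → H ms₁ false y)) _)
      (sym (cong (_+_ (pair μ a * PushGen b ms (λ ms₂ y → H ms₂ false y)))
              (trans (PushGen-+ a ms _ _)
              (cong₂ _+_ (trans (PushGen-* a ms (pair (refl-r a μ) b) (λ ms₁ x → H ms₁ x false))
                                (cong (_* PushGen a ms (λ ms₁ x → H ms₁ x false)) (pair-refl-r-orthogonal b a μ ab≡0)))
                         refl)))))

    PushWord-swap : ∀ a b → NonAdjacent a b → ∀ F → Respects≋ F → (∀ ms w → F ms (a ∷ b ∷ w) ≡ F ms (b ∷ a ∷ w)) →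
      ∀ v ms → PushWord (a ∷ b ∷ v) ms F ≡ PushWord (b ∷ a ∷ v) ms F
    PushWord-swap a b na F r sw v ms = PushWord-cong v ms (λ ms₁ v₁ →
      trans (PushGen-swap a b (pair-α-nonAdjacent b a (NonAdjacent-sym na)) (pair-α-nonAdjacent a b na)
                          (λ ms₂ x y → F ms₂ (consIf x a (consIf y b v₁))) (λ es x y → r es _) ms₁)
            (PushGen-cong a ms₁ (λ ms₂ x → PushGen-cong b ms₂ (λ ms₃ y → consIf-swap v₁ x y ms₃))))
      where
      consIf-swap : ∀ v₁ x y ms₃ → F ms₃ (consIf x a (consIf y b v₁)) ≡ F ms₃ (consIf y b (consIf x a v₁))
      consIf-swap v₁ true true ms₃ = sw ms₃ v₁
      consIf-swap v₁ true false ms₃ = refl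
      consIf-swap v₁ false true ms₃ = refl
      consIf-swap v₁ false false ms₃ = refl

module SameLetters where

  open Cyclic
  open CycDecWords

  module _ {m : ℕ} where
    private W = Word m

    elemOf-split : ∀ (a : Fin (suc m)) (v : W) → elemOf a v ≡ true → Σ W (λ v1 → Σ W (λ v2 → v ≡ v1 ++ a ∷ v2))
    elemOf-split a [] ()
    elemOf-split a (x ∷ v) e with x == a in ex
    ... | true = [] , v , cong (_∷ v) (==⇒≡ ex)
    ... | false with elemOf-split a v e
    ... | v1 , v2 , refl = x ∷ v1 , v2 , refl

    cycDec-tail : ∀ (x : Fin (suc m)) u → cycDec (x ∷ u) ≡ true → cycDec u ≡ true
    cycDec-tail x u c = proj₂ (proj₂ (cycDec-∷⁻ x u c))

    cycDec-suffix : ∀ (v1 v2 : W) → cycDec (v1 ++ v2) ≡ true → cycDec v2 ≡ true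
    cycDec-suffix [] v2 c = c
    cycDec-suffix (x ∷ v1) v2 c = cycDec-suffix v1 v2 (cycDec-tail x (v1 ++ v2) c)

    elemOf-remove : ∀ (p a : Fin (suc m)) (v1 v2 : W) → ¬ a ≡ p → elemOf p (v1 ++ a ∷ v2) ≡ elemOf p (v1 ++ v2)
    elemOf-remove p a v1 v2 ne rewrite elemOf-++ p v1 (a ∷ v2) | elemOf-++ p v1 v2 | ==-≢ ne = refl

    elemOf-remove-false : ∀ (p a : Fin (suc m)) (v1 v2 : W) → elemOf p (v1 ++ a ∷ v2) ≡ false → elemOf p (v1 ++ v2) ≡ false
    elemOf-remove-false p a v1 v2 e rewrite elemOf-++ p v1 (a ∷ v2) | elemOf-++ p v1 v2 with ∨-false {elemOf p v1} e
    ... | e1 , e2 rewrite e1 = proj₂ (∨-false {a == p} e2)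

    cycDec-remove : ∀ (v1 : W) a v2 → cycDec (v1 ++ a ∷ v2) ≡ true → cycDec (v1 ++ v2) ≡ true
    cycDec-remove [] a v2 c = cycDec-tail a v2 c
    cycDec-remove (x ∷ v1) a v2 c with cycDec-∷⁻ x (v1 ++ a ∷ v2) c
    ... | e1 , e2 , c' rewrite elemOf-remove-false x a v1 v2 e1 | elemOf-remove-false (sucMod x) a v1 v2 e2 = cycDec-remove v1 a v2 c'

    -- Two cyclically decreasing words with the same letters differ by commutations of non-adjacent
    -- letters, so any value of words built letter by letter and invariant under such commutations
    -- agrees on them.
    module Connected {Fun A : Set} (sem : Fun → W → A) (cons : Fin (suc m) → Fun → Fun)
                (sem-cons : ∀ f i u → sem f (i ∷ u) ≡ sem (cons i f) u)
                (Good : Fun → Set) (good-cons : ∀ f i → Good f → Good (cons i f))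
                (swap : ∀ f → Good f → ∀ a b → NonAdjacent a b → ∀ w → sem f (a ∷ b ∷ w) ≡ sem f (b ∷ a ∷ w)) where

      move-to-front : ∀ f → Good f → ∀ a (v1 : W) w → (∀ x → elemOf x v1 ≡ true → NonAdjacent a x) → sem f (v1 ++ a ∷ w) ≡ sem f (a ∷ v1 ++ w)
      move-to-front f g a [] w na = refl
      move-to-front f g a (x ∷ v1) w na =
        trans (sem-cons f x _)
        (trans (move-to-front (cons x f) (good-cons f x g) a v1 w (λ y e → na y (∨-trueʳ (x == y) e)))
        (trans (sym (sem-cons f x _))
        (swap f g x a (NonAdjacent-sym (na x (∨-trueˡ (elemOf x v1) (==-refl x)))) _)))

      same-letters : ∀ f → Good f → ∀ (u v : W) → cycDec u ≡ true → cycDec v ≡ true → (∀ p → elemOf p u ≡ elemOf p v) → sem f u ≡ sem f v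
      same-letters f g [] [] cu cv e = refl
      same-letters f g [] (x ∷ v) cu cv e = ⊥-elim (true≢false (trans (sym (∨-trueˡ (elemOf x v) (==-refl x))) (sym (e x))))
      same-letters f g (a ∷ u) v cu cv e with elemOf-split a v (trans (sym (e a)) (∨-trueˡ (elemOf a u) (==-refl a)))
      ... | v1 , v2 , refl =
        trans (sem-cons f a u)
        (trans (same-letters (cons a f) (good-cons f a g) u (v1 ++ v2) (cycDec-tail a u cu) (cycDec-remove v1 a v2 cv) mem)
        (trans (sym (sem-cons f a (v1 ++ v2))) (sym (move-to-front f g a v1 v2 nonadj))))
        where
        cua = cycDec-∷⁻ a u cu
        nonadj : ∀ x → elemOf x v1 ≡ true → NonAdjacent a x
        nonadj x ex = n1 , n2 , n3
          where
          pre = cycDec-prefix⁻ v1 (a ∷ v2) cv x ex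
          n1 : ¬ a ≡ x
          n1 refl = true≢false (trans (sym (∨-trueˡ (elemOf a v2) (==-refl a))) (proj₁ pre))
          n3 : ¬ sucMod x ≡ a
          n3 e' = true≢false (trans (sym (∨-trueˡ (elemOf a v2) (==-refl a))) (trans (cong (λ z → elemOf z (a ∷ v2)) (sym e')) (proj₂ pre)))
          xu : elemOf x u ≡ true
          xu = trans (sym (∨-falseˡ {a == x} (==-≢ n1))) (trans (e x) (trans (elemOf-++ x v1 (a ∷ v2)) (∨-trueˡ _ ex)))
          n2 : ¬ sucMod a ≡ x
          n2 refl = true≢false (trans (sym xu) (proj₁ (proj₂ cua)))
        mem : ∀ p → elemOf p u ≡ elemOf p (v1 ++ v2)
        mem p with a Fin.≟ p
        ... | no ne = trans (sym (BP.∨-identityˡ (elemOf p u))) (trans (cong (_∨ elemOf p u) (sym (==-≢ ne))) (trans (e p) (elemOf-remove p a v1 v2 ne)))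
        ... | yes refl = trans (proj₁ cua) (sym (trans (elemOf-++ a v1 v2) (cong₂ _∨_ av1 av2)))
          where
          av2 : elemOf a v2 ≡ false
          av2 = proj₁ (cycDec-∷⁻ a v2 (cycDec-suffix v1 (a ∷ v2) cv))
          av1 : elemOf a v1 ≡ false
          av1 = BP.¬-not (λ ea → true≢false (trans (sym (∨-trueˡ (elemOf a v2) (==-refl a))) (proj₁ (cycDec-prefix⁻ v1 (a ∷ v2) cv a ea))))


module SameLettersSameValue where

  open Expansion
  open Commutant
  open Cyclic
  open Windows
  open NonAdjacentSwap
  open SameLetters

  module _ {k : ℕ} where
    private
      m = suc k
      W = Word m
      Ws = List (Weight m)

    evalFromMaybe : Maybe (Window m) → W → Maybe (Window m)
    evalFromMaybe mW u = mW >>= λ W' → evalFrom W' u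

    stepMaybe : Fin (suc m) → Maybe (Window m) → Maybe (Window m)
    stepMaybe i mW = mW >>= λ W' → if ascent W' i then just (rmul W' i) else nothing

    evalFromMaybe-∷ : ∀ f i u → evalFromMaybe f (i ∷ u) ≡ evalFromMaybe (stepMaybe i f) u
    evalFromMaybe-∷ nothing i u = refl
    evalFromMaybe-∷ (just W') i u with ascent W' i
    ... | true = refl
    ... | false = refl

    evalFromMaybe-swap : ∀ f → ⊤ → ∀ a b → NonAdjacent a b → ∀ w → evalFromMaybe f (a ∷ b ∷ w) ≡ evalFromMaybe f (b ∷ a ∷ w)
    evalFromMaybe-swap nothing _ a b na w = refl
    evalFromMaybe-swap (just W') _ a b na w = evalFrom-swap W' a b w na

    module EvalConnected = Connected evalFromMaybe stepMaybe evalFromMaybe-∷ (λ _ → ⊤) (λ _ _ _ → tt) evalFromMaybe-swap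

    evalFrom-same-letters : ∀ W0 (u v : W) → cycDec u ≡ true → cycDec v ≡ true → (∀ p → elemOf p u ≡ elemOf p v) →
      evalFrom W0 u ≡ evalFrom W0 v
    evalFrom-same-letters W0 u v = EvalConnected.same-letters (just W0) tt u v

    SwapInvariant : (Ws → W → ℤ) → Set
    SwapInvariant F = Respects≋ F × (∀ a b → NonAdjacent a b → ∀ ms p q → F ms (p ++ a ∷ b ∷ q) ≡ F ms (p ++ b ∷ a ∷ q))

    prefixPushGen : Fin (suc m) → (Ws → W → ℤ) → (Ws → W → ℤ)
    prefixPushGen i F ms' v = PushGen i ms' (λ ms'' b → F ms'' (consIf b i v))

    SwapInvariant-prefix : ∀ F i → SwapInvariant F → SwapInvariant (prefixPushGen i F)
    SwapInvariant-prefix F i g =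
      (λ es v → PushGen-respects≋ i _ (λ es' b → proj₁ g es' _) es) ,
      (λ a b na ms p q → PushGen-cong i ms (λ ms'' β →
         trans (cong (F ms'') (consIf-++ β i p (a ∷ b ∷ q)))
         (trans (proj₂ g a b na ms'' (consIf β i p) q) (sym (cong (F ms'') (consIf-++ β i p (b ∷ a ∷ q)))))))

    module _ (ms : Ws) where
      pushWordFrom : (Ws → W → ℤ) → W → ℤ
      pushWordFrom F u = PushWord u ms F

      module PushConnected = Connected pushWordFrom prefixPushGen (λ F i u → refl) SwapInvariant SwapInvariant-prefix
        (λ F g a b na w → PushWord-swap a b na F (proj₁ g) (λ ms' w' → proj₂ g a b na ms' [] w') w ms)

      PushWord-same-letters : ∀ F → SwapInvariant F → ∀ (u v : W) → cycDec u ≡ true → cycDec v ≡ true → (∀ p → elemOf p u ≡ elemOf p v) →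
        PushWord u ms F ≡ PushWord v ms F
      PushWord-same-letters = PushConnected.same-letters

    prodAt0-respects≋ : ∀ {ms ms' : Ws} → ms ≋ ms' → prodAt0 ms ≡ prodAt0 ms'
    prodAt0-respects≋ [] = refl
    prodAt0-respects≋ (_ ∷ _) = refl

    SwapInvariant-φ₀At : ∀ W0 (G : Maybe (Window m) → ℤ) → SwapInvariant (λ ms' v → prodAt0 ms' * G (evalFrom W0 v))
    SwapInvariant-φ₀At W0 G = (λ es v → cong (_* G (evalFrom W0 v)) (prodAt0-respects≋ es)) ,
      (λ a b na ms p q → cong (λ z → prodAt0 ms * G z)
        (trans (evalFrom-++ W0 p (a ∷ b ∷ q))
          (trans (evalFromMaybe-swap (evalFrom W0 p) tt a b na q) (sym (evalFrom-++ W0 p (b ∷ a ∷ q))))))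

    φ₀At-same-letters : ∀ rest W0 G (u v : W) → cycDec u ≡ true → cycDec v ≡ true → (∀ p → elemOf p u ≡ elemOf p v) →
      φ₀At u rest W0 G ≡ φ₀At v rest W0 G
    φ₀At-same-letters rest W0 G = PushWord-same-letters rest _ (SwapInvariant-φ₀At W0 G)


module DescendingRuns where

  open SingleWeight
  open Cyclic
  open Windows
  open CycDecWords
  open Roots
  open ≡-Reasoning
  open +-*-Solver using (solve; _:+_; _:*_; _:=_; con; :-_; _:-_)

  module _ {k : ℕ} (l : Weight (suc k)) where
    private
      m = suc k
      L = Fin (suc m)
      W = Word m

    -- ⟨λ, α_a^∨ + α_{a−1}^∨ + ⋯⟩ along the run a, a − 1, … whose later members lie in S (at most
    -- t steps down): this is what ⟨r_v λ, α_a^∨⟩ becomes for a cyclically decreasing v with letters S.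
    runPairing : (L → Bool) → ℕ → L → ℤ
    runPairing S zero a = pair l a
    runPairing S (suc t) a = pair l a + (if S (predMod a) then runPairing S t (predMod a) else + 0)

    runPairing-cong : ∀ {S S'} → (∀ p → S p ≡ S' p) → ∀ t a → runPairing S t a ≡ runPairing S' t a
    runPairing-cong e zero a = refl
    runPairing-cong {S} {S'} e (suc t) a rewrite e (predMod a) with S' (predMod a)
    ... | true = cong (_+_ (pair l a)) (runPairing-cong e t (predMod a))
    ... | false = refl

    runPairing-extend : ∀ (S : L → Bool) j → S (sucMod j) ≡ false → ∀ t a → ¬ sucMod j ≡ a →
      runPairing (λ p → (j == p) ∨ S p) t a ≡ runPairing S t a
    runPairing-extend S j e zero a ne = refl
    runPairing-extend S j e (suc t) a ne with j Fin.≟ predMod a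
    ... | yes refl = ⊥-elim (ne (sucMod-predMod a))
    ... | no nj with S (predMod a) in ep
    ... | true = cong (_+_ (pair l a)) (runPairing-extend S j e t (predMod a) (λ e' → true≢false (trans (sym ep) (trans (cong S (sym e')) e))))
    ... | false = refl

    runPairing-stop : ∀ (S : L → Bool) t a → S (predMod a) ≡ false → runPairing S (suc t) a ≡ pair l a
    runPairing-stop S t a e rewrite e = ℤP.+-identityʳ _

    mutual
      pair-reflectAll : ∀ (v : W) a t → cycDec v ≡ true → elemOf a v ≡ false → elemOf (sucMod a) v ≡ false →
        length v ℕ.≤ t → pair (reflectAll v l) a ≡ runPairing (λ p → elemOf p v) t a
      pair-reflectAll [] a zero c e1 e2 le = refl
      pair-reflectAll [] a (suc t) c e1 e2 le = sym (ℤP.+-identityʳ _)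
      pair-reflectAll (j ∷ v) a (suc t) c e1 e2 (s≤s le) = pair-reflectAll-∷ j v a t c e1 e2 le (j Fin.≟ predMod a)

      pair-reflectAll-∷ : ∀ j (v : W) a t → cycDec (j ∷ v) ≡ true → elemOf a (j ∷ v) ≡ false → elemOf (sucMod a) (j ∷ v) ≡ false →
        length v ℕ.≤ t → Dec (j ≡ predMod a) → pair (reflectAll (j ∷ v) l) a ≡ runPairing (λ p → elemOf p (j ∷ v)) (suc t) a
      pair-reflectAll-∷ j v a t c e1 e2 le d with cycDec-∷⁻ j v c | d
      ... | jv , sjv , cv | yes refl = begin
          pair (refl-r (predMod a) (reflectAll v l)) a
            ≡⟨ pair-refl-r (predMod a) (reflectAll v l) a ⟩
          pair (reflectAll v l) a - pair (reflectAll v l) (predMod a) * pair (α (predMod a)) a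
            ≡⟨ cong (λ z → pair (reflectAll v l) a - pair (reflectAll v l) (predMod a) * z) (pair-α-predMod a adjne) ⟩
          pair (reflectAll v l) a - pair (reflectAll v l) (predMod a) * (- + 1)
            ≡⟨ minus-times-minus-one (pair (reflectAll v l) a) (pair (reflectAll v l) (predMod a)) ⟩
          pair (reflectAll v l) a + pair (reflectAll v l) (predMod a)
            ≡⟨ cong₂ _+_ (trans (pair-reflectAll v a (suc t) cv e1' e2' (ℕP.m≤n⇒m≤1+n le)) (runPairing-stop _ t a jv))
                         (pair-reflectAll v (predMod a) t cv jv sv le) ⟩
          pair l a + runPairing (λ p → elemOf p v) t (predMod a)
            ≡⟨ cong (_+_ (pair l a)) (sym (runPairing-extend (λ p → elemOf p v) (predMod a) sv t (predMod a) (λ e → predMod≢ a (sym (trans (sym (sucMod-predMod a)) e))))) ⟩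
          pair l a + runPairing (λ p → elemOf p (predMod a ∷ v)) t (predMod a)
            ≡⟨ cong (λ z → pair l a + (if z then runPairing (λ p → elemOf p (predMod a ∷ v)) t (predMod a) else + 0)) (sym (∨-trueˡ (elemOf (predMod a) v) (==-refl (predMod a)))) ⟩
          runPairing (λ p → elemOf p (predMod a ∷ v)) (suc t) a ∎
        where
        e1' : elemOf a v ≡ false
        e1' = proj₂ (∨-false {(predMod a) == a} e1)
        e2' : elemOf (sucMod a) v ≡ false
        e2' = proj₂ (∨-false {(predMod a) == (sucMod a)} e2)
        sv : elemOf (sucMod (predMod a)) v ≡ false
        sv = trans (cong (λ z → elemOf z v) (sucMod-predMod a)) e1'
        adjne : ¬ predMod a ≡ sucMod a
        adjne e = true≢false (trans (sym (∨-trueˡ (elemOf (sucMod a) v) (trans (cong ((predMod a) ==_) (sym e)) (==-refl (predMod a))))) e2)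
        minus-times-minus-one : ∀ x y → x - y * (- + 1) ≡ x + y
        minus-times-minus-one = solve 2 (λ x y → x :- y :* (:- con (+ 1)) := x :+ y) refl
      ... | jv , sjv , cv | no nj =
        trans (pair-refl-r-orthogonal a j (reflectAll v l) (pair-α-nonAdjacent j a na))
        (trans (pair-reflectAll v a (suc t) cv e1' e2' (ℕP.m≤n⇒m≤1+n le))
        (sym (runPairing-extend (λ p → elemOf p v) j sjv (suc t) a (λ e → nj (trans (sym (predMod-sucMod j)) (cong predMod e))))))
        where
        e1' : elemOf a v ≡ false
        e1' = proj₂ (∨-false {j == a} e1)
        e2' : elemOf (sucMod a) v ≡ false
        e2' = proj₂ (∨-false {j == (sucMod a)} e2)
        na : NonAdjacent j a
        na = (λ e → true≢false (trans (sym (∨-trueˡ (elemOf a v) (trans (cong (j ==_) (sym e)) (==-refl j)))) e1)) ,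
             (λ e → nj (trans (sym (predMod-sucMod j)) (cong predMod e))) ,
             (λ e → true≢false (trans (sym (∨-trueˡ (elemOf (sucMod a) v) (trans (cong (j ==_) e) (==-refl j)))) e2))


module Deletion where

  open Sums
  open SingleWeight
  open Cyclic
  open CycDecWords
  open DescendingRuns

  module _ {m : ℕ} where
    private
      L = Fin (suc m)
      W = Word m

    delete : L → W → W
    delete a [] = []
    delete a (x ∷ u) = if x == a then u else x ∷ delete a u

    delete-head : ∀ a u → delete a (a ∷ u) ≡ u
    delete-head a u rewrite ==-refl a = refl

    delete-∷-≢ : ∀ a x u → ¬ x ≡ a → delete a (x ∷ u) ≡ x ∷ delete a u
    delete-∷-≢ a x u ne rewrite ==-≢ ne = refl

    elemOf-delete⁻ : ∀ p a u → elemOf p (delete a u) ≡ true → elemOf p u ≡ true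
    elemOf-delete⁻ p a [] e = e
    elemOf-delete⁻ p a (x ∷ u) e with x == a
    ... | true = ∨-trueʳ (x == p) e
    ... | false with x == p
    ... | true = refl
    ... | false = elemOf-delete⁻ p a u e

    elemOf-delete-∉ : ∀ p a u → elemOf p u ≡ false → elemOf p (delete a u) ≡ false
    elemOf-delete-∉ p a u e = BP.¬-not (λ e' → true≢false (trans (sym (elemOf-delete⁻ p a u e')) e))

    ∑-cong-elemOf : ∀ (u : W) {f g : L → ℤ} → (∀ a → elemOf a u ≡ true → f a ≡ g a) → ∑ f u ≡ ∑ g u
    ∑-cong-elemOf [] e = refl
    ∑-cong-elemOf (x ∷ u) e = cong₂ _+_ (e x (∨-trueˡ (elemOf x u) (==-refl x))) (∑-cong-elemOf u (λ a ea → e a (∨-trueʳ (x == a) ea)))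

  module _ {k : ℕ} (l : Weight (suc k)) where
    private
      m = suc k
      L = Fin (suc m)
      W = Word m

    absorb-cycDec : ∀ (u : W) → cycDec u ≡ true → length u ℕ.≤ suc m → ∀ K →
      absorb u l K ≡ ∑ (λ a → runPairing l (λ p → elemOf p (delete a u)) m a * K (delete a u)) u
    absorb-cycDec [] c le K = refl
    absorb-cycDec (i ∷ u) c (s≤s le) K with cycDec-∷⁻ i u c
    ... | iu , siu , cu =
      trans (cong₂ _+_ (absorb-cycDec u cu (ℕP.m≤n⇒m≤1+n le) (λ v → K (i ∷ v)))
                       (cong (_* K u) (pair-reflectAll l u i m cu iu siu le)))
      (trans (ℤP.+-comm (∑ (λ a → runPairing l (λ p → elemOf p (delete a u)) m a * K (i ∷ delete a u)) u) (runPairing l (λ p → elemOf p u) m i * K u))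
      (cong₂ _+_ (cong₂ (λ x y → runPairing l (λ p → elemOf p x) m i * K y) (sym (delete-head i u)) (sym (delete-head i u)))
                 (∑-cong-elemOf u (λ a ea → step a ea))))
      where
      step : ∀ a → elemOf a u ≡ true →
        runPairing l (λ p → elemOf p (delete a u)) m a * K (i ∷ delete a u) ≡ runPairing l (λ p → elemOf p (delete a (i ∷ u))) m a * K (delete a (i ∷ u))
      step a ea = trans (cong (_* K (i ∷ delete a u))
                    (sym (runPairing-extend l (λ p → elemOf p (delete a u)) i (elemOf-delete-∉ (sucMod i) a u siu) m a
                       (λ e → true≢false (trans (sym ea) (trans (cong (λ z → elemOf z u) (sym e)) siu))))))
                  (cong (λ z → runPairing l (λ p → elemOf p z) m a * K z) (sym (delete-∷-≢ a i u i≢a)))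
        where
        i≢a : ¬ i ≡ a
        i≢a e = true≢false (trans (sym ea) (trans (cong (λ z → elemOf z u) (sym e)) iu))


module RunSums where

  open Sums
  open Cyclic
  open Roots
  open DescendingRuns
  open CycDecWords using (true≢false)

  module _ {m : ℕ} where
    private L = Fin (suc m)

    ∑Fin-predMod : ∀ (g : L → ℤ) → ∑Fin (g ∘ predMod) ≡ ∑Fin g
    ∑Fin-predMod g = trans (ℤP.+-comm (g (fromℕ m)) (∑Fin {m} (g ∘ inject₁))) (sym (∑Fin-last g))

    predMod^ : ℕ → L → L
    predMod^ zero a = a
    predMod^ (suc s) a = predMod^ s (predMod a)

    predMod^-+ : ∀ s t a → predMod^ (s ℕ.+ t) a ≡ predMod^ t (predMod^ s a)
    predMod^-+ zero t a = refl
    predMod^-+ (suc s) t a = predMod^-+ s t (predMod a)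

    toℕ-predMod^ : ∀ s (y : L) → s ℕ.≤ toℕ y → toℕ (predMod^ s y) ≡ toℕ y ∸ s
    toℕ-predMod^ zero y le = refl
    toℕ-predMod^ (suc s) (suc j) (s≤s le) = trans (toℕ-predMod^ s (inject₁ j) (subst (s ℕ.≤_) (sym (FinP.toℕ-inject₁ j)) le))
                                               (cong (_∸ s) (FinP.toℕ-inject₁ j))

    predMod^-toℕ : ∀ (y : L) → predMod^ (toℕ y) y ≡ zero
    predMod^-toℕ y = FinP.toℕ-injective (trans (toℕ-predMod^ (toℕ y) y ℕP.≤-refl) (ℕP.n∸n≡0 (toℕ y)))

    predMod^-reaches : ∀ (y z : L) → Σ ℕ (λ t → t ℕ.≤ m × predMod^ t y ≡ z)
    predMod^-reaches y z with toℕ z ℕP.≤? toℕ y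
    ... | yes le = (toℕ y ∸ toℕ z) , ℕP.≤-trans (ℕP.m∸n≤m (toℕ y) (toℕ z)) (ℕP.≤-pred (FinP.toℕ<n y)) ,
                   FinP.toℕ-injective (trans (toℕ-predMod^ (toℕ y ∸ toℕ z) y (ℕP.m∸n≤m (toℕ y) (toℕ z))) (ℕP.m∸[m∸n]≡n le))
    ... | no gt = (suc (toℕ y) ℕ.+ (m ∸ toℕ z)) , bound , eq
      where
      zlt : toℕ y ℕ.< toℕ z
      zlt = ℕP.≰⇒> gt
      zle : toℕ z ℕ.≤ m
      zle = ℕP.≤-pred (FinP.toℕ<n z)
      bound : suc (toℕ y) ℕ.+ (m ∸ toℕ z) ℕ.≤ m
      bound = ℕP.≤-trans (ℕP.+-monoˡ-≤ (m ∸ toℕ z) zlt) (ℕP.≤-reflexive (ℕP.m+[n∸m]≡n zle))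
      top : predMod^ (suc (toℕ y)) y ≡ fromℕ m
      top = trans (trans (cong (λ s → predMod^ s y) (ℕP.+-comm 1 (toℕ y))) (predMod^-+ (toℕ y) 1 y)) (cong predMod (predMod^-toℕ y))
      eq : predMod^ (suc (toℕ y) ℕ.+ (m ∸ toℕ z)) y ≡ z
      eq = trans (predMod^-+ (suc (toℕ y)) (m ∸ toℕ z) y) (trans (cong (predMod^ (m ∸ toℕ z)) top)
             (FinP.toℕ-injective (trans (toℕ-predMod^ (m ∸ toℕ z) (fromℕ m) (subst ((m ∸ toℕ z) ℕ.≤_) (sym (FinP.toℕ-fromℕ m)) (ℕP.m∸n≤m m (toℕ z))))
                (trans (cong (_∸ (m ∸ toℕ z)) (FinP.toℕ-fromℕ m)) (ℕP.m∸[m∸n]≡n zle)))))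

  module _ {k : ℕ} (l : Weight (suc k)) where
    private
      m = suc k
      L = Fin (suc m)

    runPairing-saturated : ∀ (B : L → Bool) t a s → 1 ℕ.≤ s → s ℕ.≤ suc t → B (predMod^ s a) ≡ false → runPairing l B (suc t) a ≡ runPairing l B t a
    runPairing-saturated B zero a (suc zero) _ _ e rewrite e = ℤP.+-identityʳ _
    runPairing-saturated B zero a (suc (suc s)) _ (s≤s ()) e
    runPairing-saturated B (suc t) a s p q e with B (predMod a) in ep
    ... | false = refl
    ... | true with s
    ... | suc zero = ⊥-elim (true≢false (trans (sym ep) e))
    ... | suc (suc s') = cong (_+_ (pair l a)) (runPairing-saturated B t (predMod a) (suc s') (s≤s z≤n) (ℕP.≤-pred q) e)

    -- Since B misses z, runs stop before wrapping around, so R(a) = ⟨λ, α_a^∨⟩ + [a − 1 ∈ B] R(a − 1);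
    -- summing over a and using Σ_a ⟨λ, α_a^∨⟩ = 0 gives Σ_a R(a) = Σ_{a ∈ B} R(a).
    ∑-runPairing-outside : ∀ (B : L → Bool) z → B z ≡ false → ∑Fin (λ a → indicator (not (B a)) * runPairing l B m a) ≡ + 0
    ∑-runPairing-outside B z bz = +-cancelʳ Inside Outside (+ 0) (begin
      Outside + Inside
        ≡⟨ sym (∑Fin-+ (λ a → indicator (not (B a)) * R a) (λ a → indicator (B a) * R a)) ⟩
      ∑Fin (λ a → indicator (not (B a)) * R a + indicator (B a) * R a)
        ≡⟨ ∑Fin-cong split ⟩
      ∑Fin R
        ≡⟨ trans (∑Fin-cong unfold) (∑Fin-+ (pair l) (λ a → indicator (B (predMod a)) * runPairing l B k (predMod a))) ⟩
      ∑Fin (pair l) + ∑Fin (λ a → indicator (B (predMod a)) * runPairing l B k (predMod a))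
        ≡⟨ cong₂ _+_ (∑Fin-pair l) (trans (∑Fin-predMod (λ a → indicator (B a) * runPairing l B k a)) (∑Fin-cong saturate)) ⟩
      + 0 + Inside ∎)
      where
      open ≡-Reasoning
      R : L → ℤ
      R = runPairing l B m
      Inside = ∑Fin (λ a → indicator (B a) * R a)
      Outside = ∑Fin (λ a → indicator (not (B a)) * R a)

      split : ∀ a → indicator (not (B a)) * R a + indicator (B a) * R a ≡ R a
      split a with B a
      ... | true = trans (ℤP.+-identityˡ _) (ℤP.*-identityˡ _)
      ... | false = trans (ℤP.+-identityʳ _) (ℤP.*-identityˡ _)

      unfold : ∀ a → R a ≡ pair l a + indicator (B (predMod a)) * runPairing l B k (predMod a)
      unfold a with B (predMod a)
      ... | true = cong (_+_ (pair l a)) (sym (ℤP.*-identityˡ _))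
      ... | false = refl

      saturate : ∀ y → indicator (B y) * runPairing l B k y ≡ indicator (B y) * R y
      saturate y with B y in eb
      ... | false = refl
      ... | true with predMod^-reaches y z
      ... | zero , _ , e = ⊥-elim (true≢false (trans (sym eb) (trans (cong B e) bz)))
      ... | suc t , le , e = cong (+ 1 *_) (sym (runPairing-saturated B k y (suc t) (s≤s z≤n) le (trans (cong B e) bz)))


module Subsets where

  open Sums

  allSubsets : ∀ n → List (Vec Bool n)
  allSubsets zero = [] ∷ []
  allSubsets (suc n) = map (false ∷_) (allSubsets n) ++ map (true ∷_) (allSubsets n)

  sameBool : Bool → Bool → Bool
  sameBool true true = true
  sameBool false false = true
  sameBool _ _ = false

  sameSubset : ∀ {n} → Vec Bool n → Vec Bool n → Bool
  sameSubset [] [] = true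
  sameSubset (x ∷ xs) (y ∷ ys) = sameBool x y ∧ sameSubset xs ys

  sameSubset-refl : ∀ {n} (S : Vec Bool n) → sameSubset S S ≡ true
  sameSubset-refl [] = refl
  sameSubset-refl (true ∷ S) = sameSubset-refl S
  sameSubset-refl (false ∷ S) = sameSubset-refl S

  sameSubset⇒≡ : ∀ {n} {S T : Vec Bool n} → sameSubset S T ≡ true → S ≡ T
  sameSubset⇒≡ {S = []} {[]} e = refl
  sameSubset⇒≡ {S = true ∷ S} {true ∷ T} e = cong (true ∷_) (sameSubset⇒≡ e)
  sameSubset⇒≡ {S = false ∷ S} {false ∷ T} e = cong (false ∷_) (sameSubset⇒≡ e)

  size : ∀ {n} → Vec Bool n → ℕ
  size [] = 0
  size (true ∷ S) = suc (size S)
  size (false ∷ S) = size S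

  []≔-restore : ∀ {n} (S : Vec Bool n) a b {c} → lookup S a ≡ c → (S [ a ]≔ b) [ a ]≔ c ≡ S
  []≔-restore S a b e = trans (VecP.[]≔-idempotent S a) (trans (cong (S [ a ]≔_) (sym e)) (VecP.[]≔-lookup S a))

  size-insert : ∀ {n} (S : Vec Bool n) a → lookup S a ≡ false → size (S [ a ]≔ true) ≡ suc (size S)
  size-insert (false ∷ S) zero refl = refl
  size-insert (true ∷ S) (suc a) e = cong suc (size-insert S a e)
  size-insert (false ∷ S) (suc a) e = size-insert S a e

  missing-element : ∀ {n} (S : Vec Bool n) → ℕ.suc (size S) ℕ.≤ n → Σ (Fin n) (λ z → lookup S z ≡ false)
  missing-element (false ∷ S) le = zero , refl
  missing-element (true ∷ S) (s≤s le) with missing-element S le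
  ... | z , e = suc z , e

  ∑-allSubsets : ∀ {n} (f : Vec Bool (suc n) → ℤ) → ∑ f (allSubsets (suc n)) ≡ ∑ (λ S → f (false ∷ S)) (allSubsets n) + ∑ (λ S → f (true ∷ S)) (allSubsets n)
  ∑-allSubsets {n} f = trans (∑-++ f (map (false ∷_) (allSubsets n)) (map (true ∷_) (allSubsets n)))
    (cong₂ _+_ (∑-map f (false ∷_) (allSubsets n)) (∑-map f (true ∷_) (allSubsets n)))

  ∑-indicator-false : ∀ {n} (f : Vec Bool n → ℤ) → ∑ (λ S → indicator false * f S) (allSubsets n) ≡ + 0
  ∑-indicator-false {n} f = trans (∑-cong (allSubsets n) (λ S → ℤP.*-zeroˡ (f S))) (∑-zero (allSubsets n))

  ∑-sameSubset : ∀ {n} (s : Vec Bool n) (g : Vec Bool n → ℤ) → ∑ (λ S → indicator (sameSubset S s) * g S) (allSubsets n) ≡ g s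
  ∑-sameSubset [] g = trans (ℤP.+-identityʳ _) (ℤP.*-identityˡ _)
  ∑-sameSubset {suc n} (true ∷ s) g =
    trans (∑-allSubsets (λ S → indicator (sameSubset S (true ∷ s)) * g S))
    (trans (cong (_+ ∑ (λ S → indicator (sameSubset S s) * g (true ∷ S)) (allSubsets n)) (∑-indicator-false (λ S → g (false ∷ S))))
    (trans (ℤP.+-identityˡ _) (∑-sameSubset s (λ S → g (true ∷ S)))))
  ∑-sameSubset {suc n} (false ∷ s) g =
    trans (∑-allSubsets (λ S → indicator (sameSubset S (false ∷ s)) * g S))
    (trans (cong (_+_ (∑ (λ S → indicator (sameSubset S s) * g (false ∷ S)) (allSubsets n))) (∑-indicator-false (λ S → g (true ∷ S))))
    (trans (ℤP.+-identityʳ _) (∑-sameSubset s (λ S → g (false ∷ S)))))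

  ∑-reindex-insert : ∀ {n} (a : Fin n) (f : Vec Bool n → ℤ) →
    ∑ (λ S → indicator (lookup S a) * f S) (allSubsets n) ≡ ∑ (λ B → indicator (not (lookup B a)) * f (B [ a ]≔ true)) (allSubsets n)
  ∑-reindex-insert {suc n} zero f =
    trans (∑-allSubsets (λ S → indicator (lookup S zero) * f S))
    (trans (cong (_+ ∑ (λ S → indicator true * f (true ∷ S)) (allSubsets n)) (∑-indicator-false (λ S → f (false ∷ S))))
    (trans (ℤP.+-identityˡ (∑ (λ S → indicator true * f (true ∷ S)) (allSubsets n)))
    (trans (sym (ℤP.+-identityʳ (∑ (λ S → indicator true * f (true ∷ S)) (allSubsets n))))
    (trans (cong (_+_ (∑ (λ S → indicator true * f (true ∷ S)) (allSubsets n))) (sym (∑-indicator-false (λ S → f (true ∷ S)))))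
    (sym (∑-allSubsets (λ B → indicator (not (lookup B zero)) * f (B [ zero ]≔ true))))))))
  ∑-reindex-insert {suc n} (suc a) f =
    trans (∑-allSubsets (λ S → indicator (lookup S (suc a)) * f S))
    (trans (cong₂ _+_ (∑-reindex-insert a (λ S → f (false ∷ S))) (∑-reindex-insert a (λ S → f (true ∷ S))))
    (sym (∑-allSubsets (λ B → indicator (not (lookup B (suc a))) * f (B [ suc a ]≔ true)))))

module Deduplication where

  open Sums
  open Subsets

  sameSubset-sym : ∀ {n} (S T : Vec Bool n) → sameSubset S T ≡ sameSubset T S
  sameSubset-sym [] [] = refl
  sameSubset-sym (true ∷ S) (true ∷ T) = sameSubset-sym S T
  sameSubset-sym (true ∷ S) (false ∷ T) = refl
  sameSubset-sym (false ∷ S) (true ∷ T) = refl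
  sameSubset-sym (false ∷ S) (false ∷ T) = sameSubset-sym S T

  module _ {A : Set} where

    -- Deduplication modulo a relation R that, on good elements, holds exactly when the keys agree:
    -- summing over the survivors is summing over the keys that occur.
    module _ {R : B.Rel A Level.zero} (R? : B.Decidable R) {n : ℕ} (key : A → Vec Bool n) (Good : A → Set)
             (hyp : ∀ x y → Good x → Good y → does (R? x y) ≡ sameSubset (key x) (key y)) where

      All-deduplicate : ∀ xs → All Good xs → All Good (deduplicate R? xs)
      All-deduplicate [] [] = []
      All-deduplicate (x ∷ xs) (q ∷ qs) = q ∷ AllP.filter⁺ (¬? ∘ R? x) (All-deduplicate xs qs)

      hasKey : List A → Vec Bool n → Bool
      hasKey xs S = any (λ x → sameSubset (key x) S) xs

      ∑-deduplicate : ∀ xs → All Good xs → ∀ (f : Vec Bool n → ℤ) →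
        ∑ (f ∘ key) (deduplicate R? xs) ≡ ∑ (λ S → indicator (hasKey xs S) * f S) (allSubsets n)
      ∑-deduplicate [] [] f = sym (∑-indicator-false f)
      ∑-deduplicate (x ∷ xs) (q ∷ qs) f =
        trans (cong (_+_ (f (key x)))
          (trans (∑-filter (¬? ∘ R? x) (f ∘ key) (deduplicate R? xs))
          (trans (∑-cong-All (deduplicate R? xs) (All-deduplicate xs qs) (λ y good-y → cong (λ z → indicator (not z) * f (key y)) (hyp x y q good-y)))
          (∑-deduplicate xs qs (λ S → indicator (not (sameSubset (key x) S)) * f S)))))
        (trans (cong (_+ ∑ (λ S → indicator (hasKey xs S) * (indicator (not (sameSubset (key x) S)) * f S)) (allSubsets n)) (sym (∑-sameSubset (key x) f)))
        (trans (sym (∑-+ (λ S → indicator (sameSubset S (key x)) * f S) (λ S → indicator (hasKey xs S) * (indicator (not (sameSubset (key x) S)) * f S)) (allSubsets n)))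
        (∑-cong (allSubsets n) split)))
        where
        split : ∀ S → indicator (sameSubset S (key x)) * f S + indicator (hasKey xs S) * (indicator (not (sameSubset (key x) S)) * f S) ≡ indicator (hasKey (x ∷ xs) S) * f S
        split S rewrite sameSubset-sym S (key x) with sameSubset (key x) S
        ... | true = trans (cong (_+_ (+ 1 * f S)) (trans (cong (indicator (hasKey xs S) *_) (ℤP.*-zeroˡ (f S))) (ℤP.*-zeroʳ (indicator (hasKey xs S))))) (ℤP.+-identityʳ _)
        ... | false = trans (ℤP.+-identityˡ _) (cong (indicator (hasKey xs S) *_) (ℤP.*-identityˡ (f S)))


module CanonicalWords where

  open Cyclic
  open Windows using (lookup-ext)
  open CycDecWords
  open Deletion
  open RunSums
  open Subsets

  module _ {m : ℕ} where
    private
      L = Fin (suc m)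
      W = Word m

    letters : W → Vec Bool (suc m)
    letters u = tabulate (λ p → elemOf p u)

    lookup-letters : ∀ u p → lookup (letters u) p ≡ elemOf p u
    lookup-letters u p = VecP.lookup∘tabulate (λ q → elemOf q u) p

    letters-∷ : ∀ x u → elemOf x u ≡ false → letters (x ∷ u) ≡ letters u [ x ]≔ true
    letters-∷ x u e = lookup-ext pt
      where
      pt : ∀ p → lookup (letters (x ∷ u)) p ≡ lookup (letters u [ x ]≔ true) p
      pt p with x Fin.≟ p
      ... | yes refl = trans (lookup-letters (x ∷ u) x) (trans (∨-trueˡ (elemOf x u) (==-refl x)) (sym (VecP.lookup∘update x (letters u) true)))
      ... | no ne = trans (lookup-letters (x ∷ u) p) (trans (∨-falseˡ (==-≢ ne)) (sym (trans (VecP.lookup∘update′ (ne ∘ sym) (letters u) true) (lookup-letters u p))))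

    size-empty : ∀ n → size (tabulate {n} (λ _ → false)) ≡ 0
    size-empty zero = refl
    size-empty (suc n) = size-empty n

    size-letters : ∀ (u : W) → cycDec u ≡ true → size (letters u) ≡ length u
    size-letters [] c = size-empty (suc m)
    size-letters (x ∷ u) c with cycDec-∷⁻ x u c
    ... | xu , _ , cu = trans (cong size (letters-∷ x u xu))
        (trans (size-insert (letters u) x (trans (lookup-letters u x) xu)) (cong suc (size-letters u cu)))

    elemOf-delete-≢ : ∀ p a (u : W) → ¬ a ≡ p → elemOf p (delete a u) ≡ elemOf p u
    elemOf-delete-≢ p a [] ne = refl
    elemOf-delete-≢ p a (x ∷ u) ne with x Fin.≟ a
    ... | yes refl = sym (∨-falseˡ (==-≢ ne))
    ... | no _ = cong ((x == p) ∨_) (elemOf-delete-≢ p a u ne)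

    elemOf-delete-self : ∀ a (u : W) → cycDec u ≡ true → elemOf a (delete a u) ≡ false
    elemOf-delete-self a [] c = refl
    elemOf-delete-self a (x ∷ u) c with cycDec-∷⁻ x u c | x Fin.≟ a
    ... | xu , _ , cu | yes refl = xu
    ... | xu , _ , cu | no ne = trans (∨-falseˡ (==-≢ ne)) (elemOf-delete-self a u cu)

    letters-delete : ∀ a (u : W) → cycDec u ≡ true → letters (delete a u) ≡ letters u [ a ]≔ false
    letters-delete a u c = lookup-ext pt
      where
      pt : ∀ p → lookup (letters (delete a u)) p ≡ lookup (letters u [ a ]≔ false) p
      pt p with a Fin.≟ p
      ... | yes refl = trans (lookup-letters (delete a u) a) (trans (elemOf-delete-self a u c) (sym (VecP.lookup∘update a (letters u) false)))
      ... | no ne = trans (lookup-letters (delete a u) p) (trans (elemOf-delete-≢ p a u ne) (sym (trans (VecP.lookup∘update′ (ne ∘ sym) (letters u) false) (lookup-letters u p))))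

    filterWord : (L → Bool) → W → W
    filterWord P [] = []
    filterWord P (x ∷ u) = if P x then x ∷ filterWord P u else filterWord P u

    elemOf-filterWord : ∀ P p (u : W) → elemOf p (filterWord P u) ≡ (P p ∧ elemOf p u)
    elemOf-filterWord P p [] = sym (BP.∧-zeroʳ (P p))
    elemOf-filterWord P p (x ∷ u) with P x in px
    ... | true = trans (cong ((x == p) ∨_) (elemOf-filterWord P p u)) (lemT (x == p) (P p) (elemOf p u) (λ e → trans (cong P (sym (==⇒≡ e))) px))
      where
      lemT : ∀ b c d → (b ≡ true → c ≡ true) → (b ∨ (c ∧ d)) ≡ (c ∧ (b ∨ d))
      lemT true c d f rewrite f refl = refl
      lemT false c d f = refl
    ... | false = trans (elemOf-filterWord P p u) (lemF (x == p) (P p) (elemOf p u) (λ e → trans (cong P (sym (==⇒≡ e))) px))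
      where
      lemF : ∀ b c d → (b ≡ true → c ≡ false) → (c ∧ d) ≡ (c ∧ (b ∨ d))
      lemF true c d f rewrite f refl = refl
      lemF false c d f = refl

    elemOf-filterWord-false : ∀ P p (u : W) → elemOf p u ≡ false → elemOf p (filterWord P u) ≡ false
    elemOf-filterWord-false P p u e = trans (elemOf-filterWord P p u) (trans (cong (P p ∧_) e) (BP.∧-zeroʳ (P p)))

    cycDec-filterWord : ∀ P (u : W) → cycDec u ≡ true → cycDec (filterWord P u) ≡ true
    cycDec-filterWord P [] c = refl
    cycDec-filterWord P (x ∷ u) c with cycDec-∷⁻ x u c
    ... | e1 , e2 , cu with P x
    ... | true rewrite elemOf-filterWord-false P x u e1 | elemOf-filterWord-false P (sucMod x) u e2 = cycDec-filterWord P u cu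
    ... | false = cycDec-filterWord P u cu

    descent : ℕ → L → W
    descent zero x = []
    descent (suc t) x = x ∷ descent t (predMod x)

    elemOf-descent⁻ : ∀ t y p → elemOf p (descent t y) ≡ true → Σ ℕ (λ s → s ℕ.< t × predMod^ s y ≡ p)
    elemOf-descent⁻ zero y p ()
    elemOf-descent⁻ (suc t) y p e with y Fin.≟ p
    ... | yes refl = 0 , s≤s z≤n , refl
    ... | no ne with elemOf-descent⁻ t (predMod y) p e
    ... | s , lt , eq = suc s , s≤s lt , eq

    elemOf-descent⁺ : ∀ s t y → s ℕ.< t → elemOf (predMod^ s y) (descent t y) ≡ true
    elemOf-descent⁺ zero (suc t) y lt = ∨-trueˡ _ (==-refl y)
    elemOf-descent⁺ (suc s) (suc t) y (s≤s lt) = ∨-trueʳ (y == _) (elemOf-descent⁺ s t (predMod y) lt)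

    predMod^-suc : ∀ r (x : L) → predMod^ (suc r) x ≡ predMod (predMod^ r x)
    predMod^-suc r x = trans (cong (λ z → predMod^ z x) (ℕP.+-comm 1 r)) (predMod^-+ r 1 x)

    predMod^-no-fixpoint : ∀ r (x : L) → 0 ℕ.< r → r ℕ.≤ m → ¬ predMod^ r x ≡ x
    predMod^-no-fixpoint r x p q e with r ℕP.≤? toℕ x
    ... | yes le = ℕP.<-irrefl refl (subst (ℕ._< toℕ x) (trans (sym (toℕ-predMod^ r x le)) (cong toℕ e)) (ℕP.∸-monoʳ-< p le))
    ... | no gt = ℕP.<-irrefl refl (subst (toℕ x ℕ.<_) (trans cnt (cong toℕ e)) bigger)
      where
      s = r ∸ suc (toℕ x)
      rs : suc (toℕ x) ℕ.+ s ≡ r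
      rs = ℕP.m+[n∸m]≡n (ℕP.≰⇒> gt)
      top : predMod^ (suc (toℕ x)) x ≡ fromℕ m
      top = trans (predMod^-suc (toℕ x) x) (cong predMod (predMod^-toℕ x))
      sle : s ℕ.≤ m
      sle = ℕP.≤-trans (ℕP.m≤n+m s (suc (toℕ x))) (subst (ℕ._≤ m) (sym rs) q)
      cnt : toℕ (predMod^ s (fromℕ m)) ≡ toℕ (predMod^ r x)
      cnt = cong toℕ (trans (cong (predMod^ s) (sym top)) (trans (sym (predMod^-+ (suc (toℕ x)) s x)) (cong (λ z → predMod^ z x) rs)))
      bigger : toℕ x ℕ.< toℕ (predMod^ s (fromℕ m))
      bigger = subst (toℕ x ℕ.<_) (sym (trans (toℕ-predMod^ s (fromℕ m) (subst (s ℕ.≤_) (sym (FinP.toℕ-fromℕ m)) sle)) (cong (_∸ s) (FinP.toℕ-fromℕ m))))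
        (subst (ℕ._≤ m ∸ s) (ℕP.m+n∸n≡m (suc (toℕ x)) s) (ℕP.∸-monoˡ-≤ s (subst (ℕ._≤ m) (sym rs) q)))

    cycDec-descent : ∀ t (x : L) → t ℕ.≤ m → cycDec (descent t x) ≡ true
    cycDec-descent zero x le = refl
    cycDec-descent (suc t) x le = and3 e1 e2 (cycDec-descent t (predMod x) (ℕP.≤-trans (ℕP.n≤1+n t) le))
      where
      and3 : ∀ {a b c} → a ≡ false → b ≡ false → c ≡ true → (not a ∧ not b ∧ c) ≡ true
      and3 refl refl refl = refl
      e1 : elemOf x (descent t (predMod x)) ≡ false
      e1 = BP.¬-not λ e → let (s , lt , eq) = elemOf-descent⁻ t (predMod x) x e in
        predMod^-no-fixpoint (suc s) x (s≤s z≤n) (ℕP.≤-trans lt (ℕP.≤-trans (ℕP.n≤1+n t) le)) eq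
      e2 : elemOf (sucMod x) (descent t (predMod x)) ≡ false
      e2 = BP.¬-not λ e → let (s , lt , eq) = elemOf-descent⁻ t (predMod x) (sucMod x) e in
        predMod^-no-fixpoint (suc (suc s)) x (s≤s z≤n) (ℕP.≤-trans (s≤s lt) le)
          (trans (predMod^-suc (suc s) x) (trans (cong predMod eq) (predMod-sucMod x)))

    -- The letters of S read downwards from z − 1, for a letter z ∉ S: starting just below a gap
    -- makes this order cyclically decreasing.
    canonical : Vec Bool (suc m) → L → W
    canonical S z = filterWord (lookup S) (descent m (predMod z))

    cycDec-canonical : ∀ S z → cycDec (canonical S z) ≡ true
    cycDec-canonical S z = cycDec-filterWord (lookup S) (descent m (predMod z)) (cycDec-descent m (predMod z) ℕP.≤-refl)

    letters-canonical : ∀ S z → lookup S z ≡ false → letters (canonical S z) ≡ S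
    letters-canonical S z sz = lookup-ext pt
      where
      pt : ∀ p → lookup (letters (canonical S z)) p ≡ lookup S p
      pt p with z Fin.≟ p
      ... | yes refl = trans (lookup-letters (canonical S z) z) (trans (elemOf-filterWord (lookup S) z (descent m (predMod z))) (trans (cong (_∧ _) sz) (sym sz)))
      ... | no ne with predMod^-reaches z p
      ... | zero , _ , eq = ⊥-elim (ne eq)
      ... | suc s , le , eq = trans (lookup-letters (canonical S z) p) (trans (elemOf-filterWord (lookup S) p (descent m (predMod z)))
            (trans (cong (lookup S p ∧_) (subst (λ q → elemOf q (descent m (predMod z)) ≡ true) eq (elemOf-descent⁺ s m (predMod z) le))) (BP.∧-identityʳ _)))

    length-canonical : ∀ S z → lookup S z ≡ false → length (canonical S z) ≡ size S
    length-canonical S z sz = trans (sym (size-letters (canonical S z) (cycDec-canonical S z))) (cong size (letters-canonical S z sz))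


module CyclicallyDecreasingSums where

  open Sums
  open SingleWeight
  open Commutant
  open Cyclic
  open Windows using (lookup-ext)
  open CycDecWords
  open SameLettersSameValue
  open DescendingRuns
  open Deletion
  open RunSums
  open Subsets
  open Deduplication
  open CanonicalWords

  module _ {A : Set} where
    any-∈ : ∀ (f : A → Bool) {x xs} → x ∈ xs → f x ≡ true → any f xs ≡ true
    any-∈ f {x} (here refl) e = ∨-trueˡ _ e
    any-∈ f {xs = y ∷ xs} (there p) e = ∨-trueʳ (f y) (any-∈ f p e)

    any-All : ∀ {Q : A → Set} (f : A → Bool) xs → All Q xs → any f xs ≡ true → Σ A (λ x → Q x × f x ≡ true)
    any-All f (x ∷ xs) (q ∷ qs) e with f x in fx
    ... | true = x , q , fx
    ... | false = any-All f xs qs e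

  module _ {A B : Set} where
    ∈-concatMap : ∀ (f : A → List B) {a as u} → a ∈ as → u ∈ f a → u ∈ concatMap f as
    ∈-concatMap f {as = a' ∷ as} (here refl) p = MemP.∈-++⁺ˡ p
    ∈-concatMap f {as = a' ∷ as} (there q) p = MemP.∈-++⁺ʳ (f a') (∈-concatMap f q p)

    All-concatMap : ∀ {P : B → Set} (f : A → List B) as → (∀ a → All P (f a)) → All P (concatMap f as)
    All-concatMap f [] h = []
    All-concatMap f (a ∷ as) h = AllP.++⁺ (h a) (All-concatMap f as h)

  module _ {m : ℕ} where
    private
      W = Word m

    allWords-length : ∀ t → All (λ u → length u ≡ t) (allWords {m} t)
    allWords-length zero = refl ∷ []
    allWords-length (suc t) = All-concatMap _ (allFin (suc m)) (λ a → AllP.map⁺ (All.map (cong suc) (allWords-length t)))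

    ∈-allWords : ∀ (u : W) → u ∈ allWords (length u)
    ∈-allWords [] = here refl
    ∈-allWords (a ∷ u) = ∈-concatMap (λ a → map (a ∷_) (allWords (length u))) (MemP.∈-allFin a) (MemP.∈-map⁺ (a ∷_) (∈-allWords u))

    isReducedCycDec : W → Bool
    isReducedCycDec u = cycDec u ∧ is-just (evalWord u)

    All-filter-reducedCycDec : ∀ {Q : W → Set} xs → All Q xs → All (λ u → Q u × isReducedCycDec u ≡ true) (filter (λ u → T? (isReducedCycDec u)) xs)
    All-filter-reducedCycDec [] [] = []
    All-filter-reducedCycDec (x ∷ xs) (q ∷ qs) with isReducedCycDec x in e
    ... | true = (q , e) ∷ All-filter-reducedCycDec xs qs
    ... | false = All-filter-reducedCycDec xs qs

    ∈-filter-reducedCycDec : ∀ {x} xs → x ∈ xs → isReducedCycDec x ≡ true → x ∈ filter (λ u → T? (isReducedCycDec u)) xs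
    ∈-filter-reducedCycDec (y ∷ xs) (here refl) e rewrite e = here refl
    ∈-filter-reducedCycDec (y ∷ xs) (there p) e with isReducedCycDec y
    ... | true = there (∈-filter-reducedCycDec xs p e)
    ... | false = ∈-filter-reducedCycDec xs p e

  ≡ᵇ-false⇒≢ : ∀ {a b} → (a ℕ.≡ᵇ b) ≡ false → ¬ a ≡ b
  ≡ᵇ-false⇒≢ {a} {b} e eq = subst T e (ℕP.≡⇒≡ᵇ a b eq)

  module _ {k : ℕ} where
    private
      m = suc k
      W = Word m
      n = suc m

    _≟ₑ_ : (u v : W) → Dec (evalWord u ≡ evalWord v)
    u ≟ₑ v = MaybeP.≡-dec (VecP.≡-dec ℤ._≟_) (evalWord u) (evalWord v)

    CycDecOfLength : ℕ → W → Set
    CycDecOfLength i u = cycDec u ≡ true × length u ≡ i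

    letters⇒elemOf : ∀ (u v : W) → letters u ≡ letters v → ∀ p → elemOf p u ≡ elemOf p v
    letters⇒elemOf u v e p = trans (sym (lookup-letters u p)) (trans (cong (λ S → lookup S p) e) (lookup-letters v p))

    elemOf⇒letters : ∀ (u v : W) → (∀ p → elemOf p u ≡ elemOf p v) → letters u ≡ letters v
    elemOf⇒letters u v e = lookup-ext (λ p → trans (lookup-letters u p) (trans (e p) (sym (lookup-letters v p))))

    ≟ₑ-letters : ∀ i x y → CycDecOfLength i x → CycDecOfLength i y → does (x ≟ₑ y) ≡ sameSubset (letters x) (letters y)
    ≟ₑ-letters i x y (cx , _) (cy , _) with sameSubset (letters x) (letters y) in e
    ... | true = dec-true (x ≟ₑ y) (evalFrom-same-letters idWindow x y cx cy (letters⇒elemOf x y (sameSubset⇒≡ e)))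
    ... | false = dec-false (x ≟ₑ y) (λ ev → true≢false (trans (sym (subst (λ S → sameSubset (letters x) S ≡ true) (elemOf⇒letters x y (evalWord-cycDec-letters x y cx cy ev)) (sameSubset-refl (letters x)))) e))

    reducedCycDecWords : ℕ → List W
    reducedCycDecWords i = filter (λ u → T? (isReducedCycDec u)) (allWords i)


    All-CycDecOfLength : ∀ i → All (CycDecOfLength i) (reducedCycDecWords i)
    All-CycDecOfLength i = goK (reducedCycDecWords i) (All-filter-reducedCycDec (allWords i) (allWords-length i))
      where
      goK : ∀ us → All (λ u → length u ≡ i × isReducedCycDec u ≡ true) us → All (CycDecOfLength i) us
      goK [] [] = []
      goK (u ∷ us) ((l , p) ∷ ps) = (proj₁ (∧-true p) , l) ∷ goK us ps
        where
        ∧-true : ∀ {a b} → (a ∧ b) ≡ true → a ≡ true × b ≡ true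
        ∧-true {true} {true} refl = refl , refl

    ≡true⇒T : ∀ {b} → b ≡ true → T b
    ≡true⇒T refl = tt

    hasKey-size : ∀ i → i ℕ.≤ m → ∀ S → any (λ x → sameSubset (letters x) S) (reducedCycDecWords i) ≡ (size S ℕ.≡ᵇ i)
    hasKey-size i le S with size S ℕ.≡ᵇ i in ecs
    ... | true = any-∈ (λ x → sameSubset (letters x) S) (∈-filter-reducedCycDec (allWords i) (subst (λ t → u ∈ allWords t) lu (∈-allWords u)) pu)
                     (subst (λ T → sameSubset T S ≡ true) (sym (letters-canonical S z zS)) (sameSubset-refl S))
      where
      cS : size S ≡ i
      cS = ℕP.≡ᵇ⇒≡ (size S) i (≡true⇒T ecs)
      zz = missing-element S (subst (ℕ._≤ n) (cong suc (sym cS)) (s≤s le))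
      z = proj₁ zz
      zS = proj₂ zz
      u = canonical S z
      lu : length u ≡ i
      lu = trans (length-canonical S z zS) cS
      pu : isReducedCycDec u ≡ true
      pu with evalWord-cycDec u (cycDec-canonical S z)
      ... | W' , ev , _ rewrite cycDec-canonical S z | ev = refl
    ... | false with any (λ x → sameSubset (letters x) S) (reducedCycDecWords i) in ea
    ... | false = refl
    ... | true with any-All (λ x → sameSubset (letters x) S) (reducedCycDecWords i) (All-CycDecOfLength i) ea
    ... | x , (cx , lx) , vx = ⊥-elim (≡ᵇ-false⇒≢ {size S} {i} ecs (trans (cong size (sym (sameSubset⇒≡ {S = letters x} {T = S} vx))) (trans (size-letters x cx) lx)))

    ∑Fin-zero : ∀ n' → ∑Fin {n'} (λ _ → + 0) ≡ + 0
    ∑Fin-zero zero = refl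
    ∑Fin-zero (suc n') = trans (ℤP.+-identityˡ _) (∑Fin-zero n')

    ∑Fin-indicator : ∀ {n'} (x : Fin n') (g : Fin n' → ℤ) → ∑Fin (λ a → indicator (x == a) * g a) ≡ g x
    ∑Fin-indicator {suc n'} zero g = trans (cong₂ _+_ (ℤP.*-identityˡ (g zero)) (trans (∑Fin-cong {n'} (λ a → ℤP.*-zeroˡ (g (suc a)))) (∑Fin-zero n'))) (ℤP.+-identityʳ _)
    ∑Fin-indicator {suc n'} (suc x) g = trans (ℤP.+-identityˡ _) (∑Fin-indicator x (g ∘ suc))

    ∑-∑Fin-elemOf : ∀ (u : W) (g : Fin n → ℤ) → cycDec u ≡ true → ∑ g u ≡ ∑Fin (λ a → indicator (elemOf a u) * g a)
    ∑-∑Fin-elemOf [] g c = sym (trans (∑Fin-cong {n} (λ a → ℤP.*-zeroˡ (g a))) (∑Fin-zero n))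
    ∑-∑Fin-elemOf (x ∷ u) g c with cycDec-∷⁻ x u c
    ... | xu , _ , cu =
      trans (cong₂ _+_ (sym (∑Fin-indicator x g)) (∑-∑Fin-elemOf u g cu))
      (trans (sym (∑Fin-+ (λ a → indicator (x == a) * g a) (λ a → indicator (elemOf a u) * g a)))
      (∑Fin-cong pt))
      where
      pt : ∀ a → indicator (x == a) * g a + indicator (elemOf a u) * g a ≡ indicator ((x == a) ∨ elemOf a u) * g a
      pt a with x == a in ex
      ... | false = trans (ℤP.+-identityˡ _) refl
      ... | true rewrite sym (==⇒≡ {a = x} {b = a} ex) | xu = ℤP.+-identityʳ _

    cycDec-delete : ∀ a (u : W) → cycDec u ≡ true → cycDec (delete a u) ≡ true
    cycDec-delete a [] c = refl
    cycDec-delete a (x ∷ u) c with cycDec-∷⁻ x u c | (x == a)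
    ... | e1 , e2 , cu | true = cu
    ... | e1 , e2 , cu | false rewrite elemOf-delete-∉ x a u e1 | elemOf-delete-∉ (sucMod x) a u e2 = cycDec-delete a u cu

    firstMissing : ∀ {n'} → Vec Bool (suc n') → Fin (suc n')
    firstMissing {zero} (_ Vec.∷ Vec.[]) = zero
    firstMissing {suc n'} (false Vec.∷ S) = zero
    firstMissing {suc n'} (true Vec.∷ S) = suc (firstMissing S)

    firstMissing-missing : ∀ {n'} (S : Vec Bool (suc n')) z → lookup S z ≡ false → lookup S (firstMissing S) ≡ false
    firstMissing-missing {zero} (b Vec.∷ Vec.[]) zero e = e
    firstMissing-missing {suc n'} (false Vec.∷ S) z e = refl
    firstMissing-missing {suc n'} (true Vec.∷ S) (suc z) e = firstMissing-missing S z e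

    -- The degree-0 part of Σ_w A_w λ over the cyclically decreasing w of length i, regrouped by the
    -- letter set; Kˢ B evaluates K on one cyclically decreasing word with letter set B.
    module AbsorbSum (l : Weight m) (rest : List (Weight m)) (W0 : Window m) (G : Maybe (Window m) → ℤ) where
      K : W → ℤ
      K v = φ₀At v rest W0 G

      Kˢ : Vec Bool n → ℤ
      Kˢ B = K (canonical B (firstMissing B))

      term : Vec Bool n → Fin n → ℤ
      term S a = runPairing l (lookup (S [ a ]≔ false)) m a * Kˢ (S [ a ]≔ false)

      absorbˢ : Vec Bool n → ℤ
      absorbˢ S = ∑Fin (λ a → indicator (lookup S a) * term S a)

      absorb-letters : ∀ i (u : W) → CycDecOfLength i u → i ℕ.≤ m → absorb u l K ≡ absorbˢ (letters u)
      absorb-letters i u (cu , lu) le =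
        trans (absorb-cycDec l u cu (subst (ℕ._≤ suc m) (sym lu) (ℕP.≤-trans le (ℕP.n≤1+n m))) K)
        (trans (∑-∑Fin-elemOf u _ cu) (∑Fin-cong pt))
        where
        pt : ∀ a → indicator (elemOf a u) * (runPairing l (λ p → elemOf p (delete a u)) m a * K (delete a u)) ≡ indicator (lookup (letters u) a) * term (letters u) a
        pt a rewrite lookup-letters u a with elemOf a u in ea
        ... | false = trans (ℤP.*-zeroˡ (runPairing l (λ p → elemOf p (delete a u)) m a * K (delete a u))) (sym (ℤP.*-zeroˡ (term (letters u) a)))
        ... | true = cong (+ 1 *_) (cong₂ _*_ tf k0)
          where
          B = letters u [ a ]≔ false
          Bp : ∀ p → elemOf p (delete a u) ≡ lookup B p
          Bp p = trans (sym (lookup-letters (delete a u) p)) (cong (λ S → lookup S p) (letters-delete a u cu))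
          tf : runPairing l (λ p → elemOf p (delete a u)) m a ≡ runPairing l (lookup B) m a
          tf = runPairing-cong l Bp m a
          zB : lookup B (firstMissing B) ≡ false
          zB = firstMissing-missing B a (VecP.lookup∘update a (letters u) false)
          k0 : K (delete a u) ≡ Kˢ B
          k0 = φ₀At-same-letters rest W0 G (delete a u) (canonical B (firstMissing B)) (cycDec-delete a u cu) (cycDec-canonical B (firstMissing B))
                 (λ p → trans (Bp p) (trans (cong (λ S → lookup S p) (sym (letters-canonical B (firstMissing B) zB))) (lookup-letters (canonical B (firstMissing B)) p)))

      ∑-absorb-cycDecWords : ∀ i → i ℕ.≤ m → ∑ (λ u → absorb u l K) (cycDecWords i) ≡ ∑ (λ S → indicator (size S ℕ.≡ᵇ i) * absorbˢ S) (allSubsets n)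
      ∑-absorb-cycDecWords i le =
        trans (∑-cong-All (cycDecWords i) (All-deduplicate _≟ₑ_ letters (CycDecOfLength i) (≟ₑ-letters i) (reducedCycDecWords i) (All-CycDecOfLength i)) (λ u ok → absorb-letters i u ok le))
        (trans (∑-deduplicate _≟ₑ_ letters (CycDecOfLength i) (≟ₑ-letters i) (reducedCycDecWords i) (All-CycDecOfLength i) absorbˢ)
        (∑-cong (allSubsets n) (λ S → cong (λ b → indicator b * absorbˢ S) (hasKey-size i le S))))

      -- Double counting: the pairs (S, a ∈ S) with |S| = i are the pairs (S ∖ a, a ∉ S ∖ a), and for a
      -- fixed B = S ∖ a, which misses some letter since |B| < n, the terms cancel by ∑-runPairing-outside.
      ∑-absorbˢ-size : ∀ i → i ℕ.≤ m → ∑ (λ S → indicator (size S ℕ.≡ᵇ i) * absorbˢ S) (allSubsets n) ≡ + 0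
      ∑-absorbˢ-size i le =
        trans (∑-cong (allSubsets n) expand)
        (trans (∑-swap (λ S a → indicator (lookup S a) * (indicator (size S ℕ.≡ᵇ i) * term S a)) (allSubsets n) (allFin n))
        (trans (∑-cong (allFin n) (λ a → trans (∑-reindex-insert a (λ S → indicator (size S ℕ.≡ᵇ i) * term S a)) (∑-cong (allSubsets n) (reindexed a))))
        (trans (∑-swap (λ a B → indicator (not (lookup B a)) * (indicator (suc (size B) ℕ.≡ᵇ i) * (runPairing l (lookup B) m a * Kˢ B))) (allFin n) (allSubsets n))
        (trans (∑-cong (allSubsets n) vanishes) (∑-zero (allSubsets n))))))
        where
        expand : ∀ S → indicator (size S ℕ.≡ᵇ i) * absorbˢ S ≡ ∑ (λ a → indicator (lookup S a) * (indicator (size S ℕ.≡ᵇ i) * term S a)) (allFin n)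
        expand S = trans (sym (∑Fin-* (indicator (size S ℕ.≡ᵇ i)) (λ a → indicator (lookup S a) * term S a)))
               (trans (∑Fin-cong (λ a → *-left-comm (indicator (size S ℕ.≡ᵇ i)) (indicator (lookup S a)) (term S a))) (sym (∑-allFin (λ a → indicator (lookup S a) * (indicator (size S ℕ.≡ᵇ i) * term S a)))))
        reindexed : ∀ a B → indicator (not (lookup B a)) * (indicator (size (B [ a ]≔ true) ℕ.≡ᵇ i) * term (B [ a ]≔ true) a)
                   ≡ indicator (not (lookup B a)) * (indicator (suc (size B) ℕ.≡ᵇ i) * (runPairing l (lookup B) m a * Kˢ B))
        reindexed a B with lookup B a in eb
        ... | true = trans (ℤP.*-zeroˡ (indicator (size (B [ a ]≔ true) ℕ.≡ᵇ i) * term (B [ a ]≔ true) a)) (sym (ℤP.*-zeroˡ (indicator (suc (size B) ℕ.≡ᵇ i) * (runPairing l (lookup B) m a * Kˢ B))))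
        ... | false = cong (+ 1 *_) (cong₂ (λ c y → indicator (c ℕ.≡ᵇ i) * y) (size-insert B a eb)
                        (cong (λ S → runPairing l (lookup S) m a * Kˢ S) ([]≔-restore B a true eb)))
        vanishes : ∀ B → ∑ (λ a → indicator (not (lookup B a)) * (indicator (suc (size B) ℕ.≡ᵇ i) * (runPairing l (lookup B) m a * Kˢ B))) (allFin n) ≡ + 0
        vanishes B = trans (∑-cong (allFin n) (λ a → regroup (indicator (not (lookup B a))) (indicator (suc (size B) ℕ.≡ᵇ i)) (runPairing l (lookup B) m a) (Kˢ B)))
               (trans (∑-* (indicator (suc (size B) ℕ.≡ᵇ i) * Kˢ B) (λ a → indicator (not (lookup B a)) * runPairing l (lookup B) m a) (allFin n))
               (trans (cong ((indicator (suc (size B) ℕ.≡ᵇ i) * Kˢ B) *_) (∑-allFin (λ a → indicator (not (lookup B a)) * runPairing l (lookup B) m a)))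
               vanishes-B))
          where
          regroup : ∀ x c t k → x * (c * (t * k)) ≡ (c * k) * (x * t)
          regroup x c t k = trans (*-left-comm x c (t * k)) (trans (cong (c *_) (trans (sym (ℤP.*-assoc x t k)) (ℤP.*-comm (x * t) k)))
                            (sym (ℤP.*-assoc c k (x * t))))
          vanishes-B : (indicator (suc (size B) ℕ.≡ᵇ i) * Kˢ B) * ∑Fin (λ a → indicator (not (lookup B a)) * runPairing l (lookup B) m a) ≡ + 0
          vanishes-B with suc (size B) ℕ.≡ᵇ i in ec
          ... | false = trans (cong (_* ∑Fin (λ a → indicator (not (lookup B a)) * runPairing l (lookup B) m a)) (ℤP.*-zeroˡ (Kˢ B))) (ℤP.*-zeroˡ (∑Fin (λ a → indicator (not (lookup B a)) * runPairing l (lookup B) m a)))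
          ... | true with missing-element B (subst (ℕ._≤ n) (sym (ℕP.≡ᵇ⇒≡ (suc (size B)) i (≡true⇒T ec))) (ℕP.≤-trans le (ℕP.n≤1+n m)))
          ... | z , bz = trans (cong ((+ 1 * Kˢ B) *_) (∑-runPairing-outside l (lookup B) z bz)) (ℤP.*-zeroʳ (+ 1 * Kˢ B))


module Generators where

  open Sums
  open Expansion
  open SingleWeight
  open Commutant
  open CyclicallyDecreasingSums

  module _ {m : ℕ} where

    φ₀At-[] : ∀ (u : Word m) W₀ G → φ₀At u [] W₀ G ≡ G (evalFrom W₀ u)
    φ₀At-[] u W₀ G = trans (PushWord-const u _) (ℤP.*-identityˡ _)

    φ₀At-∷ : ∀ (u : Word m) l ms W₀ G → φ₀At u (l ∷ ms) W₀ G ≡ absorb u l (λ v → φ₀At v ms W₀ G)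
    φ₀At-∷ u l ms W₀ G =
      trans (PushWord-++ʷ u (l ∷ []) ms _)
      (trans (PushWord-single u l _)
      (trans (cong (_+_ (absorb u l (λ v → φ₀At v ms W₀ G)))
               (trans (PushWord-cong u ms (λ a b → ℤP.*-zeroˡ (G (evalFrom W₀ b)))) (PushWord-zero u ms)))
      (ℤP.+-identityʳ _)))

  -- For a monomial of positive degree the right-hand side is 0 (prodAt0 (l ∷ ms) = 0), and the
  -- left-hand side is the sum of the absorbed terms, which cancel.
  InB′-h : ∀ {k} (i : Fin (suc (suc k))) → InB′ (h i)
  InB′-h i W₀ G G0 [] = trans (⟨⟩-cong (h i) (λ u → φ₀At-[] u W₀ G)) (sym (ℤP.*-identityˡ _))
  InB′-h {k} i W₀ G G0 (l ∷ ms) =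
      trans (∑-map _ _ (cycDecWords (toℕ i)))
      (trans (∑-cong (cycDecWords (toℕ i)) (λ u → trans (ℤP.*-identityˡ _) (φ₀At-∷ u l ms W₀ G)))
      (trans (AbsorbSum.∑-absorb-cycDecWords {k} l ms W₀ G (toℕ i) le)
      (AbsorbSum.∑-absorbˢ-size {k} l ms W₀ G (toℕ i) le)))
      where
      le : toℕ i ≤ suc k
      le = ℕP.≤-pred (FinP.toℕ<n i)


open Commutant using (InB′-⟦⟧)
open Coefficients using (InB′⇒commutes)
open Generators using (InB′-h)

proposition7p2 : (m : ℕ) → 1 ≤ m → (b : BExpr m) (s : Poly m) →
    φ₀ (mulAS ⟦ b ⟧ s) ≈₀ scale0 (evalAt0 s) ⟦ b ⟧
proposition7p2 (suc k) _ b = InB′⇒commutes ⟦ b ⟧ (InB′-⟦⟧ InB′-h b)
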